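{- Let $p$ be an odd prime and let $\phi:\mathbb{F}_p^n\times\mathbb{F}_p^n\to\mathbb{F}_p^m$ be an alternating bilinear map with $\phi(\mathbb{F}_p^n,\mathbb{F}_p^n)=\mathbb{F}_p^m$. Let $P_\phi$ be the group with underlying set $\mathbb{F}_p^n\oplus\mathbb{F}_p^m$ and product $(v_1,u_1)\circ(v_2,u_2)=(v_1+v_2,\,u_1+u_2+\tfrac12\phi(v_1,v_2))$, so that $P_\phi\in\mathfrak{B}_{p,2}(n,m)$. Then $\kappa(\phi)=\kappa(P_\phi)$ and $\lambda(\phi)=\lambda(P_\phi)$.
   Context: For an alternating bilinear map $\phi:\mathbb{F}^n\times\mathbb{F}^n\to\mathbb{F}^m$, an orthogonal decomposition is $\mathbb{F}^n=U\oplus V$ with $U,V$ non-zero and $\phi(u,v)=0$ for all $u\in U,v\in V$ (likewise for restrictions and quotients). For $U\leq\mathbb{F}^n$, $\phi|_U$ is the restriction to $U\times U$; for $X\leq\mathbb{F}^m$, $\phi/_X$ is $\phi$ composed with $\mathbb{F}^m\to\mathbb{F}^m/X$. $\kappa(\phi)$ is the minimum $c$ such that some $(n-c)$-dimensional $U\leq\mathbb{F}^n$ has $\phi|_U$ admitting an orthogonal decomposition; $\lambda(\phi)$ is the minimum $c$ such that some $c$-dimensional $X\leq\mathbb{F}^m$ has $\phi/_X$ admitting an orthogonal decomposition. $\mathfrak{B}_{p,2}(n,m)$ is the class of non-abelian finite groups $P$ of exponent $p$ with $[P,P]\leq\mathrm{Z}(P)$, $|P/[P,P]|=p^n$, $|[P,P]|=p^m$.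 A group $H$ admits a central decomposition if there are non-trivial proper subgroups $J,K$ with $[J,K]=1$ and $H=JK$. A subgroup $S\leq P$ is regular if $[S,S]=S\cap[P,P]$. $\kappa(P)$ is the smallest $s\in\mathbb{N}$ such that some regular $S\leq P$ with $|S/[S,S]|=p^{n-s}$ admits a central decomposition; $\lambda(P)$ is the smallest $s\in\mathbb{N}$ such that some central subgroup $N$ of order $p^s$ has $P/N$ admitting a central decomposition. -}

module Defs where

open import Data.Nat using (ℕ; zero; suc; _+_; _*_; _∸_; _^_; _≤_; NonZero; _/_)
open import Data.Nat.DivMod using (_mod_)
open import Data.Fin using (Fin; toℕ)
open import Data.Vec using (Vec; []; _∷_; zipWith; map; replicate; lookup)
open import Data.List using (List; []; _∷_; length)
open import Data.List.Relation.Unary.All using (All)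
open import Data.List.Relation.Unary.Unique.Propositional using (Unique)
open import Data.List.Membership.Propositional using (_∈_)
open import Data.Product using (Σ; ∃; ∃₂; _×_; _,_)
open import Data.Sum using (_⊎_)
open import Data.Unit using (⊤)
open import Relation.Binary.PropositionalEquality using (_≡_)
open import Relation.Nullary using (¬_)

Pred : Set → Set₁
Pred A = A → Set

IsLeast : ∀ {ℓ} → (ℕ → Set ℓ) → ℕ → Set ℓ
IsLeast Q c = Q c × (∀ c' → Q c' → c ≤ c')

module GroupTheory {A : Set} (_·_ : A → A → A) (inv : A → A) (e : A) where

  IsSubgroup : Pred A → Set
  IsSubgroup H = H e × (∀ x y → H x → H y → H (x · y)) × (∀ x → H x → H (inv x))

  comm : A → A → A
  comm a b = ((inv a · inv b) · a) · b

  prodList : List A → A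
  prodList []       = e
  prodList (x ∷ xs) = x · prodList xs

  Gen : Pred A → Pred A
  Gen G x = Σ (List A) λ xs → All (λ y → G y ⊎ G (inv y)) xs × prodList xs ≡ x

  Commutators : Pred A → Pred A
  Commutators S y = ∃₂ λ a b → S a × S b × comm a b ≡ y

  Derived : Pred A → Pred A
  Derived S = Gen (Commutators S)

  Whole : Pred A
  Whole _ = ⊤

  HasCard : Pred A → ℕ → Set
  HasCard H k = Σ (List A) λ xs → length xs ≡ k × Unique xs
                  × (∀ x → (H x → x ∈ xs) × (x ∈ xs → H x))

  Regular : Pred A → Set
  Regular S = ∀ x → (Derived S x → S x × Derived Whole x)
                  × (S x × Derived Whole x → Derived S x)

  Central : Pred A → Set
  Central N = ∀ x y → N x → (x · y) ≡ (y · x)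

  -- The group H / ~ (where ~ is the congruence of a normal subgroup, or ≡)
  -- admits a central decomposition: non-trivial proper subgroups J, K of it
  -- (i.e. ~-saturated subgroups of H) with [J,K] = 1 and H = JK.
  Respects : (A → A → Set) → Pred A → Set
  Respects _~_ J = ∀ x y → x ~ y → J x → J y

  CentralDecomp : (A → A → Set) → Pred A → Set₁
  CentralDecomp _~_ H =
    Σ (Pred A) λ J → Σ (Pred A) λ K →
      IsSubgroup J × IsSubgroup K × Respects _~_ J × Respects _~_ K
      × (∀ x → J x → H x) × (∀ x → K x → H x)
      × (∃ λ j → J j × ¬ (j ~ e)) × (∃ λ k → K k × ¬ (k ~ e))
      × (∃ λ h → H h × ¬ J h) × (∃ λ h → H h × ¬ K h)
      × (∀ j k → J j → K k → (j · k) ~ (k · j))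
      × (∀ h → H h → ∃₂ λ j k → J j × K k × h ~ (j · k))

module _ (p : ℕ) ⦃ _ : NonZero p ⦄ where

  F : Set
  F = Fin p

  _+F_ : F → F → F
  a +F b = (toℕ a + toℕ b) mod p

  _*F_ : F → F → F
  a *F b = (toℕ a * toℕ b) mod p

  -F_ : F → F
  -F a = (p ∸ toℕ a) mod p

  0F : F
  0F = 0 mod p

  -- 1/2 in F_p for odd p, namely (p+1)/2
  half : F
  half = ((p + 1) / 2) mod p

  V : ℕ → Set
  V k = Vec F k

  _+V_ : ∀ {k} → V k → V k → V k
  _+V_ = zipWith _+F_

  _•_ : ∀ {k} → F → V k → V k
  a • v = map (a *F_) v

  -V_ : ∀ {k} → V k → V k
  -V_ = map -F_

  0V : ∀ k → V k
  0V k = replicate k 0F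

  lincomb : ∀ {k n} → Vec F k → Vec (V n) k → V n
  lincomb {n = n} []       []       = 0V n
  lincomb         (c ∷ cs) (b ∷ bs) = (c • b) +V lincomb cs bs

  LinIndep : ∀ {k n} → Vec (V n) k → Set
  LinIndep {k} {n} bs = ∀ cs → lincomb cs bs ≡ 0V n → cs ≡ replicate k 0F

  IsSubspace : ∀ {n} → Pred (V n) → Set
  IsSubspace {n} S = S (0V n) × (∀ u v → S u → S v → S (u +V v))
                     × (∀ a v → S v → S (a • v))

  HasDim : ∀ {n} → Pred (V n) → ℕ → Set
  HasDim {n} S d = Σ (Vec (V n) d) λ bs → LinIndep bs × (∀ i → S (lookup bs i))
                     × (∀ v → S v → ∃ λ cs → lincomb cs bs ≡ v)

  NonZeroSub : ∀ {n} → Pred (V n) → Set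
  NonZeroSub {n} S = ∃ λ v → S v × ¬ (v ≡ 0V n)

  Bil : ℕ → ℕ → Set
  Bil n m = V n → V n → V m

  IsBilinear : ∀ {n m} → Bil n m → Set
  IsBilinear φ = (∀ u v w → φ (u +V v) w ≡ φ u w +V φ v w)
               × (∀ a u w → φ (a • u) w ≡ a • φ u w)
               × (∀ u v w → φ u (v +V w) ≡ φ u v +V φ u w)
               × (∀ a u w → φ u (a • w) ≡ a • φ u w)

  IsAlternating : ∀ {n m} → Bil n m → Set
  IsAlternating {m = m} φ = ∀ v → φ v v ≡ 0V m

  sumList : ∀ {m} → List (F × V m) → V m
  sumList {m} []             = 0V m
  sumList     ((c , a) ∷ xs) = (c • a) +V sumList xs

  InSpan : ∀ {m} → Pred (V m) → Pred (V m)
  InSpan A w = Σ (List _) λ xs → All (λ ca → A (Data.Product.proj₂ ca)) xs × sumList xs ≡ w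

  ImageSpans : ∀ {n m} → Bil n m → Set
  ImageSpans {n} {m} φ = ∀ w → InSpan (λ y → ∃₂ λ u v → φ u v ≡ y) w

  -- U = U₁ ⊕ U₂ with U₁, U₂ non-zero subspaces and φ(U₁,U₂) ⊆ Z
  -- (Z = {0} for restrictions φ|_U; Z = X for quotients φ/_X)
  OrthDecomp : ∀ {n m} → Bil n m → Pred (V n) → Pred (V m) → Set₁
  OrthDecomp {n} {m} φ U Z =
    Σ (Pred (V n)) λ U₁ → Σ (Pred (V n)) λ U₂ →
      IsSubspace U₁ × IsSubspace U₂ × NonZeroSub U₁ × NonZeroSub U₂
      × (∀ u → U₁ u → U u) × (∀ u → U₂ u → U u)
      × (∀ u → U₁ u → U₂ u → u ≡ 0V n)
      × (∀ u → U u → ∃₂ λ u₁ u₂ → U₁ u₁ × U₂ u₂ × u ≡ u₁ +V u₂)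
      × (∀ u₁ u₂ → U₁ u₁ → U₂ u₂ → Z (φ u₁ u₂))

  FullSpace : ∀ {n} → Pred (V n)
  FullSpace _ = ⊤

  κφ-cand : ∀ {n m} → Bil n m → ℕ → Set₁
  κφ-cand {n} {m} φ c = c ≤ n × Σ (Pred (V n)) λ U →
    IsSubspace U × HasDim U (n ∸ c) × OrthDecomp φ U (λ y → y ≡ 0V m)

  λφ-cand : ∀ {n m} → Bil n m → ℕ → Set₁
  λφ-cand {n} {m} φ c = Σ (Pred (V m)) λ X →
    IsSubspace X × HasDim X c × OrthDecomp φ FullSpace X

  Pcar : ℕ → ℕ → Set
  Pcar n m = V n × V m

  mulP : ∀ {n m} → Bil n m → Pcar n m → Pcar n m → Pcar n m
  mulP φ (v₁ , u₁) (v₂ , u₂) = (v₁ +V v₂) , ((u₁ +V u₂) +V (half • φ v₁ v₂))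

  invP : ∀ {n m} → Pcar n m → Pcar n m
  invP (v , u) = (-V v) , (-V u)

  eP : ∀ {n m} → Pcar n m
  eP {n} {m} = 0V n , 0V m

  κP-cand : ∀ {n m} → Bil n m → ℕ → Set₁
  κP-cand {n} {m} φ s =
    let open GroupTheory (mulP φ) invP eP in
    s ≤ n × Σ (Pred (Pcar n m)) λ S →
      IsSubgroup S × Regular S
      × (∃ λ k → HasCard (Derived S) k × HasCard S (p ^ (n ∸ s) * k))
      × CentralDecomp _≡_ S

  λP-cand : ∀ {n m} → Bil n m → ℕ → Set₁
  λP-cand {n} {m} φ s =
    let open GroupTheory (mulP φ) invP eP in
    Σ (Pred (Pcar n m)) λ N →
      IsSubgroup N × Central N × HasCard N (p ^ s)
      × CentralDecomp (λ x y → N (mulP φ (invP x) y)) Whole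

module Submission where

-- Each equality of minima follows (least-transfer) from two comparisons, resting
-- on the commutator formula [x,y] = (0, φ(x₁,y₁)) in P_φ (module GroupOfForm).
-- From φ to P_φ: a decomposition U₁ ⊕ U₂ of φ|_U gives the regular subgroup
-- U ⊕ W = (U₁ ⊕ W)(U₂ ⊕ W), W = ⟨φ(U,U)⟩; one of φ/X gives one of P_φ/(0 ⊕ X).
-- From P_φ to φ: the images UJ, UK of the factors J, K are φ-orthogonal (modulo X);
-- a basis of UJ extended by vectors of UK gives the orthogonal decomposition, and
-- counting cosets of [S,S] bounds its codimension.  As UJ, UK are arbitrary
-- predicates, such bases exist only classically; but the existence of this finite
-- certificate (two families of vectors) is decidable, so excluded middle for
-- membership in UJ, UK may be assumed.

open import Defs
open import Data.Nat using (ℕ; NonZero; _%_; _≤_)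
open import Data.Nat.Properties using (≤-trans; ≤-antisym)
open import Data.Nat.Primality using (Prime)
open import Data.Product using (_×_; ∃; _,_)
open import Function.Bundles using (_⇔_; mk⇔)
open import Relation.Binary.PropositionalEquality using (_≡_; subst)

module PrimeField (p : ℕ) ⦃ _ : NonZero p ⦄ where

  open import Data.Nat using (zero; suc; _+_; _*_; _∸_; _<_; _/_)
  open import Data.Nat.Properties
    using (+-comm; +-assoc; +-identityʳ; *-comm; *-assoc; *-identityˡ; *-distribˡ-+; m+[n∸m]≡n; <⇒≤)
  open import Data.Nat.DivMod
    using (_mod_; m%n<n; m<n⇒m%n≡m; %-distribˡ-+; %-distribˡ-*; n%n≡0; m*n%n≡0;
           [m+n]%n≡m%n; [m+kn]%n≡m%n; m≡m%n+[m/n]*n)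
  open import Data.Nat.Primality using (Prime; prime⇒nonTrivial)
  open import Data.Nat.Base using (nonTrivial⇒n>1; >-nonZero⁻¹)
  open import Data.Nat.Coprimality using (prime⇒coprime; coprime-Bézout)
  open import Data.Nat.GCD using (module Bézout)
  open import Data.Fin using (Fin; toℕ)
  open import Data.Fin.Properties using (toℕ-fromℕ<; toℕ<n; toℕ-injective)
  open import Data.Product using (Σ; _,_)
  open import Data.Empty using (⊥-elim)
  open import Relation.Nullary using (¬_)
  open import Relation.Binary.PropositionalEquality
  open import Algebra.Bundles using (CommutativeRing)
  open import Algebra.Structures {A = Fin p} _≡_ using (IsCommutativeRing)
  open import Defs using (F; _+F_; _*F_; -F_; 0F; half)

  infixl 6 _⊕_
  infixl 7 _⊗_
  infix 4 _∼_

  _⊕_ : F p → F p → F p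
  _⊕_ = _+F_ p

  _⊗_ : F p → F p → F p
  _⊗_ = _*F_ p

  ⊖_ : F p → F p
  ⊖_ = -F_ p

  𝟘 𝟙 : F p
  𝟘 = 0F p
  𝟙 = 1 mod p

  -- Field laws are proved on representatives: `a ∼ x` says that the
  -- residue a ∈ 𝔽ₚ is the class of the natural number x.
  _∼_ : F p → ℕ → Set
  a ∼ x = toℕ a ≡ x % p

  ∼-mod : ∀ x → x mod p ∼ x
  ∼-mod x = toℕ-fromℕ< (m%n<n x p)

  ∼-toℕ : ∀ a → a ∼ toℕ a
  ∼-toℕ a = sym (m<n⇒m%n≡m (toℕ<n a))

  ∼-+ : ∀ {a b x y} → a ∼ x → b ∼ y → a ⊕ b ∼ x + y
  ∼-+ {a} {b} {x} {y} ax by = begin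
    toℕ (a ⊕ b)               ≡⟨ ∼-mod (toℕ a + toℕ b) ⟩
    (toℕ a + toℕ b) % p       ≡⟨ cong₂ (λ u v → (u + v) % p) ax by ⟩
    (x % p + y % p) % p       ≡⟨ sym (%-distribˡ-+ x y p) ⟩
    (x + y) % p               ∎
    where open ≡-Reasoning

  ∼-* : ∀ {a b x y} → a ∼ x → b ∼ y → a ⊗ b ∼ x * y
  ∼-* {a} {b} {x} {y} ax by = begin
    toℕ (a ⊗ b)               ≡⟨ ∼-mod (toℕ a * toℕ b) ⟩
    (toℕ a * toℕ b) % p       ≡⟨ cong₂ (λ u v → (u * v) % p) ax by ⟩
    (x % p * (y % p)) % p     ≡⟨ sym (%-distribˡ-* x y p) ⟩
    (x * y) % p               ∎
    where open ≡-Reasoning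

  ∼-unique : ∀ {a b x y} → a ∼ x → b ∼ y → x % p ≡ y % p → a ≡ b
  ∼-unique ax by x≡y = toℕ-injective (trans ax (trans x≡y (sym by)))

  ⊕-comm : ∀ a b → a ⊕ b ≡ b ⊕ a
  ⊕-comm a b = cong (_mod p) (+-comm (toℕ a) (toℕ b))

  ⊗-comm : ∀ a b → a ⊗ b ≡ b ⊗ a
  ⊗-comm a b = cong (_mod p) (*-comm (toℕ a) (toℕ b))

  ⊕-assoc : ∀ a b c → (a ⊕ b) ⊕ c ≡ a ⊕ (b ⊕ c)
  ⊕-assoc a b c = ∼-unique (∼-+ (∼-+ (∼-toℕ a) (∼-toℕ b)) (∼-toℕ c))
                           (∼-+ (∼-toℕ a) (∼-+ (∼-toℕ b) (∼-toℕ c)))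
                           (cong (_% p) (+-assoc (toℕ a) (toℕ b) (toℕ c)))

  ⊗-assoc : ∀ a b c → (a ⊗ b) ⊗ c ≡ a ⊗ (b ⊗ c)
  ⊗-assoc a b c = ∼-unique (∼-* (∼-* (∼-toℕ a) (∼-toℕ b)) (∼-toℕ c))
                           (∼-* (∼-toℕ a) (∼-* (∼-toℕ b) (∼-toℕ c)))
                           (cong (_% p) (*-assoc (toℕ a) (toℕ b) (toℕ c)))

  ⊗-distribˡ-⊕ : ∀ a b c → a ⊗ (b ⊕ c) ≡ (a ⊗ b) ⊕ (a ⊗ c)
  ⊗-distribˡ-⊕ a b c =
    ∼-unique (∼-* (∼-toℕ a) (∼-+ (∼-toℕ b) (∼-toℕ c)))
             (∼-+ (∼-* (∼-toℕ a) (∼-toℕ b)) (∼-* (∼-toℕ a) (∼-toℕ c)))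
             (cong (_% p) (*-distribˡ-+ (toℕ a) (toℕ b) (toℕ c)))

  ⊗-distribʳ-⊕ : ∀ a b c → (b ⊕ c) ⊗ a ≡ (b ⊗ a) ⊕ (c ⊗ a)
  ⊗-distribʳ-⊕ a b c = trans (⊗-comm _ a) (trans (⊗-distribˡ-⊕ a b c) (cong₂ _⊕_ (⊗-comm a b) (⊗-comm a c)))

  ⊕-identityˡ : ∀ a → 𝟘 ⊕ a ≡ a
  ⊕-identityˡ a = ∼-unique (∼-+ (∼-mod 0) (∼-toℕ a)) (∼-toℕ a) refl

  ⊕-identityʳ : ∀ a → a ⊕ 𝟘 ≡ a
  ⊕-identityʳ a = trans (⊕-comm a 𝟘) (⊕-identityˡ a)

  ⊗-identityˡ : ∀ a → 𝟙 ⊗ a ≡ a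
  ⊗-identityˡ a = ∼-unique (∼-* (∼-mod 1) (∼-toℕ a)) (∼-toℕ a) (cong (_% p) (*-identityˡ (toℕ a)))

  ⊗-identityʳ : ∀ a → a ⊗ 𝟙 ≡ a
  ⊗-identityʳ a = trans (⊗-comm a 𝟙) (⊗-identityˡ a)

  ⊗-zeroˡ : ∀ a → 𝟘 ⊗ a ≡ 𝟘
  ⊗-zeroˡ a = ∼-unique (∼-* (∼-mod 0) (∼-toℕ a)) (∼-mod 0) refl

  ⊕-inverseʳ : ∀ a → a ⊕ (⊖ a) ≡ 𝟘
  ⊕-inverseʳ a = ∼-unique (∼-+ (∼-toℕ a) (∼-mod (p ∸ toℕ a))) (∼-mod 0) (begin
    (toℕ a + (p ∸ toℕ a)) % p   ≡⟨ cong (_% p) (m+[n∸m]≡n (<⇒≤ (toℕ<n a))) ⟩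
    p % p                       ≡⟨ n%n≡0 p ⟩
    0                           ≡⟨ sym (m<n⇒m%n≡m (>-nonZero⁻¹ p)) ⟩
    0 % p                       ∎)
    where open ≡-Reasoning

  ⊕-inverseˡ : ∀ a → (⊖ a) ⊕ a ≡ 𝟘
  ⊕-inverseˡ a = trans (⊕-comm _ a) (⊕-inverseʳ a)

  𝔽-commutativeRing : CommutativeRing _ _
  𝔽-commutativeRing = record { isCommutativeRing = isCR }
    where
    isCR : IsCommutativeRing _⊕_ _⊗_ ⊖_ 𝟘 𝟙
    isCR = record
      { isRing = record
        { +-isAbelianGroup = record
          { isGroup = record
            { isMonoid = record
              { isSemigroup = record
                { isMagma = record { isEquivalence = isEquivalence ; ∙-cong = cong₂ _⊕_ }
                ; assoc = ⊕-assoc }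
              ; identity = ⊕-identityˡ , ⊕-identityʳ }
            ; inverse = ⊕-inverseˡ , ⊕-inverseʳ
            ; ⁻¹-cong = cong ⊖_ }
          ; comm = ⊕-comm }
        ; *-cong = cong₂ _⊗_
        ; *-assoc = ⊗-assoc
        ; *-identity = ⊗-identityˡ , ⊗-identityʳ
        ; distrib = ⊗-distribˡ-⊕ , ⊗-distribʳ-⊕ }
      ; *-comm = ⊗-comm }

  open import Algebra.Properties.Ring (CommutativeRing.ring 𝔽-commutativeRing)
    using (-‿distribˡ-*; -1*x≈-x)
  open import Algebra.Properties.AbelianGroup (CommutativeRing.+-abelianGroup 𝔽-commutativeRing)
    using (inverseʳ-unique; ⁻¹-involutive)

  ⊖𝟙⊗ : ∀ a → (⊖ 𝟙) ⊗ a ≡ ⊖ a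
  ⊖𝟙⊗ = -1*x≈-x

  half-+-half : p % 2 ≡ 1 → half p ⊕ half p ≡ 𝟙
  half-+-half odd = ∼-unique (∼-+ (∼-mod q) (∼-mod q)) (∼-mod 1) (begin
    (q + q) % p   ≡⟨ cong (_% p) q+q≡p+1 ⟩
    (p + 1) % p   ≡⟨ cong (_% p) (+-comm p 1) ⟩
    (1 + p) % p   ≡⟨ [m+n]%n≡m%n 1 p ⟩
    1 % p         ∎)
    where
    open ≡-Reasoning
    q = (p + 1) / 2
    q+q≡p+1 : q + q ≡ p + 1
    q+q≡p+1 = begin
      q + q                   ≡⟨ cong (q +_) (sym (+-identityʳ q)) ⟩
      2 * q                   ≡⟨ *-comm 2 q ⟩
      q * 2                   ≡⟨ cong (_+ q * 2) (sym (trans (%-distribˡ-+ p 1 2) (cong (λ r → (r + 1) % 2) odd))) ⟩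
      (p + 1) % 2 + q * 2     ≡⟨ sym (m≡m%n+[m/n]*n (p + 1) 2) ⟩
      p + 1                   ∎

  module _ (p-prime : Prime p) where

    𝟙≢𝟘 : ¬ (𝟙 ≡ 𝟘)
    𝟙≢𝟘 𝟙≡𝟘 = 1≢0 (begin
      1         ≡⟨ sym (m<n⇒m%n≡m (nonTrivial⇒n>1 p ⦃ prime⇒nonTrivial p-prime ⦄)) ⟩
      1 % p     ≡⟨ sym (∼-mod 1) ⟩
      toℕ 𝟙     ≡⟨ cong toℕ 𝟙≡𝟘 ⟩
      toℕ 𝟘     ≡⟨ ∼-mod 0 ⟩
      0 % p     ≡⟨ m<n⇒m%n≡m (>-nonZero⁻¹ p) ⟩
      0         ∎)
      where
      open ≡-Reasoning
      1≢0 : ¬ (1 ≡ 0)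
      1≢0 ()

    -- Every non-zero residue is invertible (Bézout for the coprime pair p, a).
    inverse : ∀ a → ¬ (a ≡ 𝟘) → Σ (F p) λ b → b ⊗ a ≡ 𝟙
    inverse a a≢𝟘 = invert (toℕ a) refl
      where
      invert : ∀ t → toℕ a ≡ t → Σ (F p) λ b → b ⊗ a ≡ 𝟙
      invert zero a≡0 = ⊥-elim (a≢𝟘 (∼-unique (∼-toℕ a) (∼-mod 0) (cong (_% p) a≡0)))
      invert (suc t) a≡t with coprime-Bézout (prime⇒coprime p-prime (subst (_< p) a≡t (toℕ<n a)))
      -- 1 + x·p = y·a : then y is an inverse of a
      ... | Bézout.-+ x y eq = y mod p , ∼-unique (∼-* (∼-mod y) (∼-toℕ a)) (∼-mod 1) (begin
        (y * toℕ a) % p   ≡⟨ cong (λ r → (y * r) % p) a≡t ⟩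
        (y * suc t) % p   ≡⟨ cong (_% p) (sym eq) ⟩
        (1 + x * p) % p   ≡⟨ [m+kn]%n≡m%n 1 x p ⟩
        1 % p             ∎)
        where open ≡-Reasoning
      -- 1 + y·a = x·p : then y·a = -1, so -y is an inverse of a
      ... | Bézout.+- x y eq = ⊖ (y mod p) , (begin
        (⊖ (y mod p)) ⊗ a     ≡⟨ sym (-‿distribˡ-* (y mod p) a) ⟩
        ⊖ ((y mod p) ⊗ a)     ≡⟨ cong ⊖_ (inverseʳ-unique 𝟙 _ 𝟙+ya≡𝟘) ⟩
        ⊖ (⊖ 𝟙)               ≡⟨ ⁻¹-involutive 𝟙 ⟩
        𝟙                     ∎)
        where
        open ≡-Reasoning
        𝟙+ya≡𝟘 : 𝟙 ⊕ (y mod p) ⊗ a ≡ 𝟘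
        𝟙+ya≡𝟘 = ∼-unique (∼-+ (∼-mod 1) (∼-* (∼-mod y) (∼-toℕ a))) (∼-mod 0) (begin
          (1 + y * toℕ a) % p   ≡⟨ cong (λ r → (1 + y * r) % p) a≡t ⟩
          (1 + y * suc t) % p   ≡⟨ cong (_% p) eq ⟩
          (x * p) % p           ≡⟨ m*n%n≡0 x p ⟩
          0                     ≡⟨ sym (m<n⇒m%n≡m (>-nonZero⁻¹ p)) ⟩
          0 % p                 ∎)

module Vectors (p : ℕ) ⦃ _ : NonZero p ⦄ where

  open import Data.Nat using (zero; suc; _%_)
  open import Data.Nat.DivMod using (_mod_)
  open import Data.Fin using (toℕ)
  open import Data.Vec using (Vec; []; _∷_)
  open import Data.Vec.Properties
    using (zipWith-assoc; zipWith-comm; zipWith-identityˡ; zipWith-identityʳ; zipWith-inverseˡ; zipWith-inverseʳ)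
  open import Data.Product using (_,_)
  open import Relation.Binary.PropositionalEquality
  open import Algebra.Bundles using (AbelianGroup)
  open import Defs using (F; V; _+V_; _•_; -V_; 0V; half)

  open PrimeField p public

  infixl 6 _+ᵥ_
  infixr 7 _·ᵥ_

  _+ᵥ_ : ∀ {k} → V p k → V p k → V p k
  _+ᵥ_ = _+V_ p

  _·ᵥ_ : ∀ {k} → F p → V p k → V p k
  _·ᵥ_ = _•_ p

  -ᵥ_ : ∀ {k} → V p k → V p k
  -ᵥ_ = -V_ p

  0ᵥ : ∀ k → V p k
  0ᵥ = 0V p

  +ᵥ-abelianGroup : ℕ → AbelianGroup _ _
  +ᵥ-abelianGroup k = record
    { Carrier = V p k ; _≈_ = _≡_ ; _∙_ = _+ᵥ_ ; ε = 0ᵥ k ; _⁻¹ = -ᵥ_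
    ; isAbelianGroup = record
      { isGroup = record
        { isMonoid = record
          { isSemigroup = record
            { isMagma = record { isEquivalence = isEquivalence ; ∙-cong = cong₂ _+ᵥ_ }
            ; assoc = zipWith-assoc ⊕-assoc }
          ; identity = zipWith-identityˡ ⊕-identityˡ , zipWith-identityʳ ⊕-identityʳ }
        ; inverse = zipWith-inverseˡ ⊕-inverseˡ , zipWith-inverseʳ ⊕-inverseʳ
        ; ⁻¹-cong = cong -ᵥ_ }
      ; comm = zipWith-comm ⊕-comm } }

  module +ᵥ {k : ℕ} where
    open AbelianGroup (+ᵥ-abelianGroup k) public
      using (assoc; comm; identityˡ; identityʳ; inverseˡ; inverseʳ; commutativeMonoid)
    open import Algebra.Properties.AbelianGroup (+ᵥ-abelianGroup k) public
      using (inverseʳ-unique; ⁻¹-involutive; ε⁻¹≈ε; ⁻¹-∙-comm; ∙-cancelˡ; x∙y⁻¹≈ε⇒x≈y; \\-leftDividesˡ; \\-leftDividesʳ)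
    open import Algebra.Properties.CommutativeSemigroup (AbelianGroup.commutativeSemigroup (+ᵥ-abelianGroup k)) public
      using (interchange)

  ·ᵥ-distribˡ : ∀ {k} a (u v : V p k) → a ·ᵥ (u +ᵥ v) ≡ a ·ᵥ u +ᵥ a ·ᵥ v
  ·ᵥ-distribˡ a [] [] = refl
  ·ᵥ-distribˡ a (b ∷ u) (c ∷ v) = cong₂ _∷_ (⊗-distribˡ-⊕ a b c) (·ᵥ-distribˡ a u v)

  ·ᵥ-distribʳ : ∀ {k} a b (v : V p k) → (a ⊕ b) ·ᵥ v ≡ a ·ᵥ v +ᵥ b ·ᵥ v
  ·ᵥ-distribʳ a b [] = refl
  ·ᵥ-distribʳ a b (c ∷ v) = cong₂ _∷_ (⊗-distribʳ-⊕ c a b) (·ᵥ-distribʳ a b v)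

  ·ᵥ-assoc : ∀ {k} a b (v : V p k) → (a ⊗ b) ·ᵥ v ≡ a ·ᵥ (b ·ᵥ v)
  ·ᵥ-assoc a b [] = refl
  ·ᵥ-assoc a b (c ∷ v) = cong₂ _∷_ (⊗-assoc a b c) (·ᵥ-assoc a b v)

  ·ᵥ-identity : ∀ {k} (v : V p k) → 𝟙 ·ᵥ v ≡ v
  ·ᵥ-identity [] = refl
  ·ᵥ-identity (c ∷ v) = cong₂ _∷_ (⊗-identityˡ c) (·ᵥ-identity v)

  ·ᵥ-zeroˡ : ∀ {k} (v : V p k) → 𝟘 ·ᵥ v ≡ 0ᵥ k
  ·ᵥ-zeroˡ [] = refl
  ·ᵥ-zeroˡ (c ∷ v) = cong₂ _∷_ (⊗-zeroˡ c) (·ᵥ-zeroˡ v)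

  ·ᵥ-zeroʳ : ∀ {k} a → a ·ᵥ 0ᵥ k ≡ 0ᵥ k
  ·ᵥ-zeroʳ {k} a = +ᵥ.∙-cancelˡ (a ·ᵥ 0ᵥ k) _ _ (begin
    a ·ᵥ 0ᵥ k +ᵥ a ·ᵥ 0ᵥ k   ≡⟨ sym (·ᵥ-distribˡ a (0ᵥ k) (0ᵥ k)) ⟩
    a ·ᵥ (0ᵥ k +ᵥ 0ᵥ k)      ≡⟨ cong (a ·ᵥ_) (+ᵥ.identityˡ (0ᵥ k)) ⟩
    a ·ᵥ 0ᵥ k                ≡⟨ sym (+ᵥ.identityʳ _) ⟩
    a ·ᵥ 0ᵥ k +ᵥ 0ᵥ k        ∎)
    where open ≡-Reasoning

  ·ᵥ-neg : ∀ {k} a (v : V p k) → a ·ᵥ (-ᵥ v) ≡ -ᵥ (a ·ᵥ v)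
  ·ᵥ-neg a v = +ᵥ.inverseʳ-unique (a ·ᵥ v) _
    (trans (sym (·ᵥ-distribˡ a v (-ᵥ v))) (trans (cong (a ·ᵥ_) (+ᵥ.inverseʳ v)) (·ᵥ-zeroʳ a)))

  ⊖𝟙· : ∀ {k} (v : V p k) → (⊖ 𝟙) ·ᵥ v ≡ -ᵥ v
  ⊖𝟙· [] = refl
  ⊖𝟙· (c ∷ v) = cong₂ _∷_ (⊖𝟙⊗ c) (⊖𝟙· v)

  -- A set of vectors containing 0 and closed under addition is closed under
  -- scalars: c · v is the sum of toℕ c copies of v.
  additive⇒scalar-closed : ∀ {k} (Q : V p k → Set) → Q (0ᵥ k) → (∀ u v → Q u → Q v → Q (u +ᵥ v))
                         → ∀ c v → Q v → Q (c ·ᵥ v)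
  additive⇒scalar-closed {k} Q q0 q+ c v qv =
    subst Q (trans (copies≡ (toℕ c)) (cong (_·ᵥ v) toℕ-mod)) (copies∈Q (toℕ c))
    where
    copies : ℕ → V p k
    copies zero = 0ᵥ k
    copies (suc j) = v +ᵥ copies j

    copies∈Q : ∀ j → Q (copies j)
    copies∈Q zero = q0
    copies∈Q (suc j) = q+ _ _ qv (copies∈Q j)

    copies≡ : ∀ j → copies j ≡ (j mod p) ·ᵥ v
    copies≡ zero = sym (·ᵥ-zeroˡ v)
    copies≡ (suc j) = begin
      v +ᵥ copies j                  ≡⟨ cong₂ _+ᵥ_ (sym (·ᵥ-identity v)) (copies≡ j) ⟩
      𝟙 ·ᵥ v +ᵥ (j mod p) ·ᵥ v       ≡⟨ sym (·ᵥ-distribʳ 𝟙 _ v) ⟩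
      (𝟙 ⊕ (j mod p)) ·ᵥ v           ≡⟨ cong (_·ᵥ v) (∼-unique (∼-+ (∼-mod 1) (∼-mod j)) (∼-mod (suc j)) refl) ⟩
      (suc j mod p) ·ᵥ v             ∎
      where open ≡-Reasoning

    toℕ-mod : toℕ c mod p ≡ c
    toℕ-mod = ∼-unique (∼-mod (toℕ c)) (∼-toℕ c) refl

  halves : p % 2 ≡ 1 → ∀ {k} (x : V p k) → half p ·ᵥ x +ᵥ half p ·ᵥ x ≡ x
  halves odd x = trans (sym (·ᵥ-distribʳ (half p) (half p) x)) (trans (cong (_·ᵥ x) (half-+-half odd)) (·ᵥ-identity x))

module Enumeration where

  open import Data.Nat using (ℕ; zero; suc; _+_; _*_; _^_; _≤_; z≤n; s≤s)
  open import Data.Nat.Properties using (+-suc; +-mono-≤; ≤-trans)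
  open import Data.List using (List; []; _∷_; _++_; length; map; concatMap; cartesianProductWith)
  open import Data.List.Properties using (length-++; length-map)
  open import Data.List.Membership.Propositional using (_∈_; lose)
  open import Data.List.Membership.Propositional.Properties
    using (∈-∃++; ∈-++⁻; ∈-++⁺ˡ; ∈-++⁺ʳ; ∈-cartesianProductWith⁺)
  open import Data.List.Relation.Unary.Any as Any using (here; there; any?)
  open import Data.List.Relation.Unary.All as All using (All; []; _∷_; all?)
  open import Data.List.Relation.Unary.AllPairs using ([]; _∷_)
  open import Data.List.Relation.Unary.Unique.Propositional using (Unique)
  open import Data.List.Relation.Unary.Unique.Propositional.Properties using (cartesianProductWith⁺)
  open import Data.Vec using (Vec; []; _∷_)
  open import Data.Sum using (inj₁; inj₂)
  open import Data.Product using (∃; _×_; _,_)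
  open import Data.Empty using (⊥-elim)
  open import Relation.Nullary using (¬_; Dec; yes; no)
  open import Relation.Nullary.Decidable using (¬¬-excluded-middle)
  open import Relation.Binary.PropositionalEquality

  Unique⊆⇒length≤ : ∀ {A : Set} {xs ys : List A} → Unique xs → (∀ {x} → x ∈ xs → x ∈ ys) → length xs ≤ length ys
  Unique⊆⇒length≤ {xs = []} _ _ = z≤n
  Unique⊆⇒length≤ {xs = x ∷ xs} {ys} (x∉xs ∷ unique) xs⊆ys with ∈-∃++ (xs⊆ys (here refl))
  ... | ys₁ , ys₂ , refl = subst (suc (length xs) ≤_) (sym length-ys) (s≤s (Unique⊆⇒length≤ unique xs⊆ys₁++ys₂))
    where
    length-ys : length (ys₁ ++ x ∷ ys₂) ≡ suc (length (ys₁ ++ ys₂))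
    length-ys = trans (length-++ ys₁) (trans (+-suc (length ys₁) (length ys₂)) (cong suc (sym (length-++ ys₁))))
    xs⊆ys₁++ys₂ : ∀ {y} → y ∈ xs → y ∈ ys₁ ++ ys₂
    xs⊆ys₁++ys₂ y∈xs with ∈-++⁻ ys₁ (xs⊆ys (there y∈xs))
    ... | inj₁ y∈ys₁ = ∈-++⁺ˡ y∈ys₁
    ... | inj₂ (here refl) = ⊥-elim (All.lookup x∉xs y∈xs refl)
    ... | inj₂ (there y∈ys₂) = ∈-++⁺ʳ ys₁ y∈ys₂

  length-concatMap-≤ : ∀ {A B : Set} (f : A → List B) k xs → (∀ x → length (f x) ≤ k) → length (concatMap f xs) ≤ length xs * k
  length-concatMap-≤ f k [] _ = z≤n
  length-concatMap-≤ f k (x ∷ xs) bound =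
    subst (_≤ k + length xs * k) (sym (length-++ (f x))) (+-mono-≤ (bound x) (length-concatMap-≤ f k xs bound))

  covered-by-blocks : ∀ {A B : Set} {xs : List A} (f : B → List A) (is : List B) k → Unique xs
                    → (∀ {x} → x ∈ xs → x ∈ concatMap f is) → (∀ i → length (f i) ≤ k) → length xs ≤ length is * k
  covered-by-blocks f is k unique covered bound = ≤-trans (Unique⊆⇒length≤ unique covered) (length-concatMap-≤ f k is bound)

  length-cartesianProductWith : ∀ {A B C : Set} (f : A → B → C) xs ys
                              → length (cartesianProductWith f xs ys) ≡ length xs * length ys
  length-cartesianProductWith f [] ys = refl
  length-cartesianProductWith f (x ∷ xs) ys =
    trans (length-++ (map (f x) ys)) (cong₂ _+_ (length-map (f x) ys) (length-cartesianProductWith f xs ys))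

  vectorsOver : ∀ {A : Set} → List A → (k : ℕ) → List (Vec A k)
  vectorsOver L zero = [] ∷ []
  vectorsOver L (suc k) = cartesianProductWith _∷_ L (vectorsOver L k)

  vectorsOver-complete : ∀ {A : Set} {L : List A} → (∀ a → a ∈ L) → ∀ {k} (v : Vec A k) → v ∈ vectorsOver L k
  vectorsOver-complete complete [] = here refl
  vectorsOver-complete complete (a ∷ v) = ∈-cartesianProductWith⁺ _∷_ (complete a) (vectorsOver-complete complete v)

  vectorsOver-unique : ∀ {A : Set} {L : List A} → Unique L → ∀ k → Unique (vectorsOver L k)
  vectorsOver-unique unique zero = [] ∷ []
  vectorsOver-unique unique (suc k) = cartesianProductWith⁺ _∷_ ∷-injective unique (vectorsOver-unique unique k)
    where
    ∷-injective : ∀ {A : Set} {k} {a b : A} {u v : Vec A k} → a ∷ u ≡ b ∷ v → a ≡ b × u ≡ v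
    ∷-injective refl = refl , refl

  length-vectorsOver : ∀ {A : Set} (L : List A) k → length (vectorsOver L k) ≡ length L ^ k
  length-vectorsOver L zero = refl
  length-vectorsOver L (suc k) =
    trans (length-cartesianProductWith _∷_ L (vectorsOver L k)) (cong (length L *_) (length-vectorsOver L k))

  module _ {A : Set} (L : List A) (complete : ∀ a → a ∈ L) {P : A → Set} (P? : ∀ a → Dec (P a)) where

    ∃-dec : Dec (∃ P)
    ∃-dec with any? P? L
    ... | yes some = yes (Any.satisfied some)
    ... | no none = no (λ (a , pa) → none (lose (complete a) pa))

    ∀-dec : Dec (∀ a → P a)
    ∀-dec with all? P? L
    ... | yes all = yes (λ a → All.lookup all (complete a))
    ... | no ¬all = no (λ every → ¬all (All.tabulate (λ {a} _ → every a)))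

  -- Classically, finitely many propositions are each decided; so a decidable
  -- goal may be proved assuming such decisions.
  ¬¬-decide-all : ∀ {A : Set} (Q : A → Set) (L : List A) → ¬ ¬ All (λ a → Dec (Q a)) L
  ¬¬-decide-all Q [] k = k []
  ¬¬-decide-all Q (a ∷ L) k = ¬¬-excluded-middle (λ d → ¬¬-decide-all Q L (λ ds → k (d ∷ ds)))

module LinearAlgebra (p : ℕ) ⦃ _ : NonZero p ⦄ (p-prime : Prime p) where

  open import Data.Nat using (zero; suc; _+_; _^_; _≤_; _≤?_)
  open import Data.Nat.Properties using (≰⇒>; <⇒≱; ^-monoʳ-<; m+n≤o⇒m≤o; m+n≤o⇒n≤o)
  open import Data.Nat.Base using (nonTrivial⇒n>1)
  open import Data.Nat.Primality using (prime⇒nonTrivial)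
  open import Data.List using (List; []; _∷_; length; map; allFin)
  open import Data.List.Properties using (length-map; length-tabulate)
  open import Data.List.Membership.Propositional using (_∈_)
  open import Data.List.Membership.Propositional.Properties using (∈-allFin; ∈-map⁺; ∈-map⁻)
  open import Data.List.Relation.Unary.Any using (here; there)
  open import Data.List.Relation.Unary.All using (All; []; _∷_)
  open import Data.List.Relation.Unary.Unique.Propositional using (Unique)
  open import Data.List.Relation.Unary.Unique.Propositional.Properties using (allFin⁺; map⁺)
  open import Data.Vec as Vec using (Vec; []; _∷_; lookup; _++_; splitAt)
  open import Data.Vec.Properties using (≡-dec; ++-injectiveˡ; ++-injectiveʳ)
  open import Data.Vec.Relation.Unary.All using () renaming (All to VAll; [] to V[]; _∷_ to _V∷_)
  open import Data.Vec.Relation.Unary.All.Properties using (++⁺)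
  open import Data.Fin using (Fin; zero; suc; toℕ; fromℕ<)
  open import Data.Fin.Properties using (toℕ-fromℕ<) renaming (_≟_ to _≟F_)
  open import Data.Product using (∃; ∃₂; _×_; _,_; proj₁; proj₂)
  open import Data.Empty using (⊥-elim)
  open import Relation.Nullary using (¬_; Dec; yes; no)
  open import Relation.Nullary.Decidable using (_→-dec_; _×-dec_)
  open import Relation.Binary.PropositionalEquality
  open import Defs using (F; V; lincomb; LinIndep; IsSubspace; sumList)

  open Vectors p public
  open Enumeration

  lc : ∀ {d n} → Vec (F p) d → Vec (V p n) d → V p n
  lc = lincomb p

  Span : ∀ {d n} → Vec (V p n) d → V p n → Set
  Span bs v = ∃ λ cs → lc cs bs ≡ v

  Indep : ∀ {d n} → Vec (V p n) d → Set
  Indep = LinIndep p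

  lc-0 : ∀ {d n} (bs : Vec (V p n) d) → lc (0ᵥ d) bs ≡ 0ᵥ n
  lc-0 [] = refl
  lc-0 (b ∷ bs) = trans (cong₂ _+ᵥ_ (·ᵥ-zeroˡ b) (lc-0 bs)) (+ᵥ.identityˡ _)

  lc-+ : ∀ {d n} (cs ds : Vec (F p) d) (bs : Vec (V p n) d) → lc (cs +ᵥ ds) bs ≡ lc cs bs +ᵥ lc ds bs
  lc-+ [] [] [] = sym (+ᵥ.identityˡ _)
  lc-+ (c ∷ cs) (d ∷ ds) (b ∷ bs) = trans (cong₂ _+ᵥ_ (·ᵥ-distribʳ c d b) (lc-+ cs ds bs)) (+ᵥ.interchange _ _ _ _)

  lc-· : ∀ {d n} a (cs : Vec (F p) d) (bs : Vec (V p n) d) → lc (a ·ᵥ cs) bs ≡ a ·ᵥ lc cs bs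
  lc-· a [] [] = sym (·ᵥ-zeroʳ a)
  lc-· a (c ∷ cs) (b ∷ bs) = trans (cong₂ _+ᵥ_ (·ᵥ-assoc a c b) (lc-· a cs bs)) (sym (·ᵥ-distribˡ a _ _))

  lc-neg : ∀ {d n} (cs : Vec (F p) d) (bs : Vec (V p n) d) → lc (-ᵥ cs) bs ≡ -ᵥ lc cs bs
  lc-neg cs bs = +ᵥ.inverseʳ-unique (lc cs bs) _
    (trans (sym (lc-+ cs (-ᵥ cs) bs)) (trans (cong (λ z → lc z bs) (+ᵥ.inverseʳ cs)) (lc-0 bs)))

  lc-++ : ∀ {d e n} (cs : Vec (F p) d) (ds : Vec (F p) e) (bs : Vec (V p n) d) (es : Vec (V p n) e)
        → lc (cs ++ ds) (bs ++ es) ≡ lc cs bs +ᵥ lc ds es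
  lc-++ [] ds [] es = sym (+ᵥ.identityˡ _)
  lc-++ (c ∷ cs) ds (b ∷ bs) es = trans (cong (_ +ᵥ_) (lc-++ cs ds bs es)) (sym (+ᵥ.assoc _ _ _))

  subspace-neg : ∀ {n} {Q : V p n → Set} → IsSubspace p Q → ∀ v → Q v → Q (-ᵥ v)
  subspace-neg {Q = Q} (_ , _ , Q·) v qv = subst Q (⊖𝟙· v) (Q· (⊖ 𝟙) v qv)

  lc-closed : ∀ {d n} {Q : V p n → Set} → IsSubspace p Q → {bs : Vec (V p n) d} → VAll Q bs → ∀ cs → Q (lc cs bs)
  lc-closed (Q0 , _ , _) V[] [] = Q0
  lc-closed sub@(_ , Q+ , Q·) (qb V∷ qbs) (c ∷ cs) = Q+ _ _ (Q· c _ qb) (lc-closed sub qbs cs)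

  span⊆ : ∀ {d n} {Q : V p n → Set} → IsSubspace p Q → {bs : Vec (V p n) d} → VAll Q bs → ∀ v → Span bs v → Q v
  span⊆ sub qbs v (cs , refl) = lc-closed sub qbs cs

  sumList-closed : ∀ {k} {Z : V p k → Set} → IsSubspace p Z → ∀ {xs} → All (λ ca → Z (proj₂ ca)) xs → Z (sumList p xs)
  sumList-closed (Z0 , _ , _) [] = Z0
  sumList-closed sub@(_ , Z+ , Z·) {(c , a) ∷ _} (za ∷ zs) = Z+ _ _ (Z· c a za) (sumList-closed sub zs)

  zero-subspace : ∀ {k} → IsSubspace p (_≡ 0ᵥ k)
  zero-subspace = refl , (λ { u v refl refl → +ᵥ.identityˡ _ }) , (λ { c v refl → ·ᵥ-zeroʳ c })

  span-subspace : ∀ {d n} (bs : Vec (V p n) d) → IsSubspace p (Span bs)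
  span-subspace bs = (0ᵥ _ , lc-0 bs)
                   , (λ { u v (cs , refl) (ds , refl) → cs +ᵥ ds , lc-+ cs ds bs })
                   , (λ { a v (cs , refl) → a ·ᵥ cs , lc-· a cs bs })

  IsLinear : ∀ {k l} → (V p k → V p l) → Set
  IsLinear f = (∀ u v → f (u +ᵥ v) ≡ f u +ᵥ f v) × (∀ a u → f (a ·ᵥ u) ≡ a ·ᵥ f u)

  linear-0 : ∀ {k l} {f : V p k → V p l} → IsLinear f → f (0ᵥ k) ≡ 0ᵥ l
  linear-0 {k} {f = f} (_ , f·) = trans (cong f (sym (·ᵥ-zeroˡ (0ᵥ k)))) (trans (f· 𝟘 _) (·ᵥ-zeroˡ _))

  linear-neg : ∀ {k l} {f : V p k → V p l} → IsLinear f → ∀ v → f (-ᵥ v) ≡ -ᵥ f v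
  linear-neg {f = f} (_ , f·) v = trans (cong f (sym (⊖𝟙· v))) (trans (f· (⊖ 𝟙) v) (⊖𝟙· (f v)))

  preimage-subspace : ∀ {k l} {Z : V p l → Set} {f : V p k → V p l} → IsSubspace p Z → IsLinear f
                    → IsSubspace p (λ v → Z (f v))
  preimage-subspace {Z = Z} {f} (Z0 , Z+ , Z·) lin@(f+ , f·) =
    subst Z (sym (linear-0 lin)) Z0 ,
    (λ u v zu zv → subst Z (sym (f+ u v)) (Z+ _ _ zu zv)) ,
    (λ a v zv → subst Z (sym (f· a v)) (Z· a _ zv))

  span-lookup : ∀ {d n} (bs : Vec (V p n) d) i → Span bs (lookup bs i)
  span-lookup bs i = unit i , lc-unit i bs
    where
    unit : ∀ {d} → Fin d → Vec (F p) d
    unit {suc d} zero = 𝟙 ∷ 0ᵥ d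
    unit {suc d} (suc i) = 𝟘 ∷ unit i

    lc-unit : ∀ {d n} (i : Fin d) (bs : Vec (V p n) d) → lc (unit i) bs ≡ lookup bs i
    lc-unit zero (b ∷ bs) = trans (cong₂ _+ᵥ_ (·ᵥ-identity b) (lc-0 bs)) (+ᵥ.identityʳ b)
    lc-unit (suc i) (b ∷ bs) = trans (cong₂ _+ᵥ_ (·ᵥ-zeroˡ b) (lc-unit i bs)) (+ᵥ.identityˡ _)

  span-++ˡ : ∀ {d e n} (bs : Vec (V p n) d) (es : Vec (V p n) e) v → Span bs v → Span (bs ++ es) v
  span-++ˡ {e = e} bs es v (cs , refl) =
    cs ++ 0ᵥ e , trans (lc-++ cs (0ᵥ e) bs es) (trans (cong (lc cs bs +ᵥ_) (lc-0 es)) (+ᵥ.identityʳ _))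

  span-++ʳ : ∀ {d e n} (bs : Vec (V p n) d) (es : Vec (V p n) e) v → Span es v → Span (bs ++ es) v
  span-++ʳ {d} bs es v (cs , refl) =
    0ᵥ d ++ cs , trans (lc-++ (0ᵥ d) cs bs es) (trans (cong (_+ᵥ lc cs es) (lc-0 bs)) (+ᵥ.identityˡ _))

  span-split : ∀ {d e n} (bs : Vec (V p n) d) (es : Vec (V p n) e) u → Span (bs ++ es) u
             → ∃₂ λ u₁ u₂ → Span bs u₁ × Span es u₂ × u ≡ u₁ +ᵥ u₂
  span-split {d} bs es u (cs , refl) with splitAt d cs
  ... | α , β , refl = lc α bs , lc β es , (α , refl) , (β , refl) , lc-++ α β bs es

  indep-[] : ∀ {n} → Indep {0} {n} []
  indep-[] [] _ = refl

  indep-injective : ∀ {d n} {bs : Vec (V p n) d} → Indep bs → ∀ cs ds → lc cs bs ≡ lc ds bs → cs ≡ ds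
  indep-injective {bs = bs} ind cs ds same = +ᵥ.x∙y⁻¹≈ε⇒x≈y cs ds (ind _ (begin
    lc (cs +ᵥ -ᵥ ds) bs          ≡⟨ lc-+ cs (-ᵥ ds) bs ⟩
    lc cs bs +ᵥ lc (-ᵥ ds) bs    ≡⟨ cong₂ _+ᵥ_ same (lc-neg ds bs) ⟩
    lc ds bs +ᵥ -ᵥ lc ds bs      ≡⟨ +ᵥ.inverseʳ _ ⟩
    0ᵥ _                         ∎))
    where open ≡-Reasoning

  indep-∷ : ∀ {d n} (w : V p n) (bs : Vec (V p n) d) → Indep bs → ¬ Span bs w → Indep (w ∷ bs)
  indep-∷ w bs ind w∉ (c ∷ cs) lc≡0 with c ≟F 𝟘
  ... | yes refl = cong (𝟘 ∷_) (ind cs (trans (sym (+ᵥ.identityˡ _)) (trans (cong (_+ᵥ lc cs bs) (sym (·ᵥ-zeroˡ w))) lc≡0)))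
  ... | no c≢𝟘 with inverse p-prime c c≢𝟘
  ... | b , bc≡𝟙 = ⊥-elim (w∉ (-ᵥ (b ·ᵥ cs) , (begin
    lc (-ᵥ (b ·ᵥ cs)) bs    ≡⟨ trans (lc-neg (b ·ᵥ cs) bs) (cong -ᵥ_ (lc-· b cs bs)) ⟩
    -ᵥ (b ·ᵥ lc cs bs)      ≡⟨ sym (·ᵥ-neg b _) ⟩
    b ·ᵥ (-ᵥ lc cs bs)      ≡⟨ cong (b ·ᵥ_) (sym (+ᵥ.inverseʳ-unique (lc cs bs) (c ·ᵥ w) (trans (+ᵥ.comm _ _) lc≡0))) ⟩
    b ·ᵥ (c ·ᵥ w)           ≡⟨ sym (·ᵥ-assoc b c w) ⟩
    (b ⊗ c) ·ᵥ w            ≡⟨ cong (_·ᵥ w) bc≡𝟙 ⟩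
    𝟙 ·ᵥ w                  ≡⟨ ·ᵥ-identity w ⟩
    w                       ∎)))
    where open ≡-Reasoning

  private
    0ᵥ-++ : ∀ a b → 0ᵥ a ++ 0ᵥ b ≡ 0ᵥ (a + b)
    0ᵥ-++ zero b = refl
    0ᵥ-++ (suc a) b = cong (𝟘 ∷_) (0ᵥ-++ a b)

  indep-++ˡ : ∀ {d e n} (bs : Vec (V p n) d) (es : Vec (V p n) e) → Indep (bs ++ es) → Indep bs
  indep-++ˡ {d} {e} bs es ind cs lc≡0 = ++-injectiveˡ cs (0ᵥ d) (trans (ind (cs ++ 0ᵥ e)
    (trans (lc-++ cs (0ᵥ e) bs es) (trans (cong₂ _+ᵥ_ lc≡0 (lc-0 es)) (+ᵥ.identityˡ _)))) (sym (0ᵥ-++ d e)))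

  indep-++ʳ : ∀ {d e n} (bs : Vec (V p n) d) (es : Vec (V p n) e) → Indep (bs ++ es) → Indep es
  indep-++ʳ {d} {e} bs es ind cs lc≡0 = ++-injectiveʳ (0ᵥ d) (0ᵥ d) (trans (ind (0ᵥ d ++ cs)
    (trans (lc-++ (0ᵥ d) cs bs es) (trans (cong₂ _+ᵥ_ (lc-0 bs) lc≡0) (+ᵥ.identityˡ _)))) (sym (0ᵥ-++ d e)))

  indep-head≢0 : ∀ {d n} (w : V p n) (ws : Vec (V p n) d) → Indep (w ∷ ws) → ¬ (w ≡ 0ᵥ n)
  indep-head≢0 {d} w ws ind w≡0 = 𝟙≢𝟘 p-prime (cong Vec.head
    (ind (𝟙 ∷ 0ᵥ d) (trans (cong₂ _+ᵥ_ (·ᵥ-identity w) (lc-0 ws)) (trans (+ᵥ.identityʳ w) w≡0))))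

  spans-disjoint : ∀ {d e n} (bs : Vec (V p n) d) (es : Vec (V p n) e) → Indep (bs ++ es)
                 → ∀ u → Span bs u → Span es u → u ≡ 0ᵥ n
  spans-disjoint {d} {e} bs es ind u (α , refl) (β , lcβ≡u) = trans (cong (λ z → lc z bs) α≡0) (lc-0 bs)
    where
    α≡0 : α ≡ 0ᵥ d
    α≡0 = ++-injectiveˡ α (0ᵥ d) (trans (ind (α ++ -ᵥ β)
      (trans (lc-++ α (-ᵥ β) bs es) (trans (cong (lc α bs +ᵥ_) (trans (lc-neg β es) (cong -ᵥ_ lcβ≡u))) (+ᵥ.inverseʳ _))))
      (sym (0ᵥ-++ d e)))

  _≟ᵥ_ : ∀ {k} (u v : V p k) → Dec (u ≡ v)
  _≟ᵥ_ = ≡-dec _≟F_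

  vectors : ∀ k → List (V p k)
  vectors = vectorsOver (allFin p)

  vectors-complete : ∀ {k} (v : V p k) → v ∈ vectors k
  vectors-complete = vectorsOver-complete ∈-allFin

  vectors-unique : ∀ k → Unique (vectors k)
  vectors-unique = vectorsOver-unique (allFin⁺ p)

  length-vectors : ∀ k → length (vectors k) ≡ p ^ k
  length-vectors k = trans (length-vectorsOver (allFin p) k) (cong (_^ k) (length-tabulate (λ i → i)))

  span? : ∀ {d n} (bs : Vec (V p n) d) v → Dec (Span bs v)
  span? {d} bs v = ∃-dec (vectors d) vectors-complete (λ cs → lc cs bs ≟ᵥ v)

  indep? : ∀ {d n} (bs : Vec (V p n) d) → Dec (Indep bs)
  indep? {d} {n} bs = ∀-dec (vectors d) vectors-complete (λ cs → (lc cs bs ≟ᵥ 0ᵥ n) →-dec (cs ≟ᵥ 0ᵥ d))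

  spanList : ∀ {d n} → Vec (V p n) d → List (V p n)
  spanList {d} bs = map (λ cs → lc cs bs) (vectors d)

  spanList-unique : ∀ {d n} (bs : Vec (V p n) d) → Indep bs → Unique (spanList bs)
  spanList-unique {d} bs ind = map⁺ (λ {cs} {ds} → indep-injective ind cs ds) (vectors-unique d)

  length-spanList : ∀ {d n} (bs : Vec (V p n) d) → length (spanList bs) ≡ p ^ d
  length-spanList {d} bs = trans (length-map _ (vectors d)) (length-vectors d)

  span⇒∈spanList : ∀ {d n} (bs : Vec (V p n) d) v → Span bs v → v ∈ spanList bs
  span⇒∈spanList bs v (cs , refl) = ∈-map⁺ _ (vectors-complete cs)

  ∈spanList⇒span : ∀ {d n} (bs : Vec (V p n) d) v → v ∈ spanList bs → Span bs v
  ∈spanList⇒span bs v v∈ with ∈-map⁻ _ v∈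
  ... | cs , _ , v≡ = cs , sym v≡

  ^-cancel : ∀ {a b} → p ^ a ≤ p ^ b → a ≤ b
  ^-cancel {a} {b} pᵃ≤pᵇ with a ≤? b
  ... | yes a≤b = a≤b
  ... | no a≰b = ⊥-elim (<⇒≱ (^-monoʳ-< p (nonTrivial⇒n>1 p ⦃ prime⇒nonTrivial p-prime ⦄) (≰⇒> a≰b)) pᵃ≤pᵇ)

  indep⇒≤ : ∀ {d n} (bs : Vec (V p n) d) → Indep bs → d ≤ n
  indep⇒≤ {d} {n} bs ind = ^-cancel (subst₂ _≤_ (length-spanList bs) (length-vectors n)
    (Unique⊆⇒length≤ (spanList-unique bs ind) (λ {x} _ → vectors-complete x)))

  record Extension {n d} (Q : V p n → Set) (bs : Vec (V p n) d) (L : List (V p n)) : Set where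
    constructor extension
    field
      {size}      : ℕ
      new         : Vec (V p n) size
      independent : Indep (new ++ bs)
      new⊆Q       : VAll Q new
      covers      : ∀ u → u ∈ L → Q u → Span (new ++ bs) u

  extend : ∀ {n d} (Q : V p n → Set) (bs : Vec (V p n) d) → Indep bs
         → (L : List (V p n)) → All (λ u → Dec (Q u)) L → Extension Q bs L
  extend Q bs ind [] [] = extension [] ind V[] (λ u ())
  extend Q bs ind (u ∷ L) (Q?u ∷ Q?) with extend Q bs ind L Q?
  ... | extension new ind' qs cov with Q?u | span? (new ++ bs) u
  ...   | yes qu | no u∉ = extension (u ∷ new) (indep-∷ u _ ind' u∉) (qu V∷ qs) λ
    { w (here refl) _ → span-lookup (u ∷ new ++ bs) zero
    ; w (there w∈) qw → span-++ʳ (u ∷ []) (new ++ bs) w (cov w w∈ qw) }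
  ...   | yes qu | yes u∈ = extension new ind' qs λ
    { w (here refl) _ → u∈
    ; w (there w∈) qw → cov w w∈ qw }
  ...   | no ¬qu | _ = extension new ind' qs λ
    { w (here refl) qw → ⊥-elim (¬qu qw)
    ; w (there w∈) qw → cov w w∈ qw }

  record Basis {n} (Q : V p n → Set) (L : List (V p n)) : Set where
    constructor basis
    field
      {dim}       : ℕ
      family      : Vec (V p n) dim
      independent : Indep family
      family⊆Q    : VAll Q family
      covers      : ∀ u → u ∈ L → Q u → Span family u

  basis-of : ∀ {n} (Q : V p n → Set) (L : List (V p n)) → All (λ u → Dec (Q u)) L → Basis Q L
  basis-of Q L Q? with extend Q [] indep-[] L Q?
  ... | extension new ind qs cov = basis (new ++ []) ind (++⁺ qs V[]) cov

  -- Their sizes are bounded by n, so they range over a finite set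
  -- and the existence of such a pair satisfying a decidable condition is decidable.
  IndepPair : ∀ {n} → (∀ {a b} → Vec (V p n) (suc a) → Vec (V p n) (suc b) → Set) → Set
  IndepPair {n} G = ∃ λ (a : Fin n) → ∃ λ (b : Fin n) → ∃ λ (es : Vec (V p n) (suc (toℕ a))) →
                    ∃ λ (fs : Vec (V p n) (suc (toℕ b))) → Indep (fs ++ es) × G es fs

  indepPair? : ∀ {n} {G : ∀ {a b} → Vec (V p n) (suc a) → Vec (V p n) (suc b) → Set}
             → (∀ {a b} es fs → Dec (G {a} {b} es fs)) → Dec (IndepPair G)
  indepPair? {n} G? =
    ∃-dec (allFin n) ∈-allFin λ a → ∃-dec (allFin n) ∈-allFin λ b →
    ∃-dec (families (suc (toℕ a))) families-complete λ es → ∃-dec (families (suc (toℕ b))) families-complete λ fs →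
    indep? (fs ++ es) ×-dec G? es fs
    where
    families : ∀ k → List (Vec (V p n) k)
    families = vectorsOver (vectors n)
    families-complete : ∀ {k} (fs : Vec (V p n) k) → fs ∈ families k
    families-complete = vectorsOver-complete vectors-complete

  private
    toFin : ∀ {k n} → suc k ≤ n → ∃ λ (i : Fin n) → toℕ i ≡ k
    toFin k<n = fromℕ< k<n , toℕ-fromℕ< k<n

  indepPair : ∀ {n a b} {G : ∀ {a b} → Vec (V p n) (suc a) → Vec (V p n) (suc b) → Set}
              (es : Vec (V p n) (suc a)) (fs : Vec (V p n) (suc b)) → Indep (fs ++ es) → G es fs → IndepPair G
  indepPair {n} {a} {b} es fs ind g
    with toFin (m+n≤o⇒n≤o (suc b) (indep⇒≤ (fs ++ es) ind)) | toFin (m+n≤o⇒m≤o (suc b) (indep⇒≤ (fs ++ es) ind))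
  ... | i , refl | j , refl = i , j , es , fs , ind , g

  record SumBasis {n} (A B R : V p n → Set) : Set where
    constructor sumBasis
    field
      {a b}       : ℕ
      es          : Vec (V p n) (suc a)
      fs          : Vec (V p n) (suc b)
      independent : Indep (fs ++ es)
      es⊆A        : VAll A es
      fs⊆B        : VAll B fs
      spanning    : ∀ v → R v → Span (fs ++ es) v

  module _ {n} {A B R : V p n → Set} (A-subspace : IsSubspace p A)
           (R⊆A+B : ∀ v → R v → ∃₂ λ u₁ u₂ → A u₁ × B u₂ × v ≡ u₁ +ᵥ u₂)
           (R⊈A : ¬ (∀ v → R v → A v)) (R⊈B : ¬ (∀ v → R v → B v)) where

    private
      nonempty : ∀ {a b} (es : Vec (V p n) a) (fs : Vec (V p n) b) → Indep (fs ++ es) → VAll A es → VAll B fs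
               → (∀ u → A u → Span es u) → (∀ u → B u → Span (fs ++ es) u) → SumBasis A B R
      -- es = [] forces A = 0, so R ⊆ B
      nonempty [] fs _ _ _ A⊆⟨es⟩ _ = ⊥-elim (R⊈B R⊆B)
        where
        R⊆B : ∀ v → R v → B v
        R⊆B v v∈ with R⊆A+B v v∈
        ... | u₁ , u₂ , a₁ , b₂ , refl with A⊆⟨es⟩ u₁ a₁
        ... | [] , refl = subst B (sym (+ᵥ.identityˡ u₂)) b₂
      -- fs = [] forces B ⊆ ⟨es⟩ ⊆ A, so R ⊆ A
      nonempty (_ ∷ _) [] _ es⊆A _ _ B⊆⟨es⟩ = ⊥-elim (R⊈A R⊆A)
        where
        R⊆A : ∀ v → R v → A v
        R⊆A v v∈ with R⊆A+B v v∈
        ... | u₁ , u₂ , a₁ , b₂ , refl = proj₁ (proj₂ A-subspace) u₁ u₂ a₁ (span⊆ A-subspace es⊆A u₂ (B⊆⟨es⟩ u₂ b₂))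
      nonempty es@(_ ∷ _) fs@(_ ∷ _) indep es⊆A fs⊆B A⊆⟨es⟩ B⊆⟨fs,es⟩ = sumBasis es fs indep es⊆A fs⊆B spanning
        where
        spanning : ∀ v → R v → Span (fs ++ es) v
        spanning v v∈ with R⊆A+B v v∈
        ... | u₁ , u₂ , a₁ , b₂ , refl =
          proj₁ (proj₂ (span-subspace (fs ++ es))) u₁ u₂ (span-++ʳ fs es u₁ (A⊆⟨es⟩ u₁ a₁)) (B⊆⟨fs,es⟩ u₂ b₂)

    sum-basis : All (λ u → Dec (A u)) (vectors n) → All (λ u → Dec (B u)) (vectors n) → SumBasis A B R
    sum-basis A? B? with basis-of A (vectors n) A?
    ... | basis es es-indep es⊆A es-covers with extend B es es-indep (vectors n) B?
    ...   | extension fs indep fs⊆B fs-covers =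
      nonempty es fs indep es⊆A fs⊆B (λ u → es-covers u (vectors-complete u)) (λ u → fs-covers u (vectors-complete u))

module Forms (p : ℕ) ⦃ _ : NonZero p ⦄ (p-prime : Prime p)
             {n m : ℕ} (φ : Bil p n m) (bil : IsBilinear p φ) (alt : IsAlternating p φ) where

  open import Data.Nat using (suc; _*_)
  open import Data.Vec using (Vec; _∷_; _++_; lookup; map; _⊛*_)
  open import Data.Vec.Properties using (lookup-map; lookup-⊛*)
  open import Data.Vec.Relation.Unary.All.Properties using (lookup⁻)
  open import Data.Fin using (Fin; zero; combine)
  open import Data.Fin.Properties using (combine-surjective)
  open import Data.Product using (∃₂; _,_; proj₁; proj₂)
  open import Relation.Binary.PropositionalEquality
  open import Defs using (V; IsSubspace; OrthDecomp)

  open LinearAlgebra p p-prime public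

  φ-linearˡ : ∀ w → IsLinear (λ u → φ u w)
  φ-linearˡ w = (λ u v → proj₁ bil u v w) , (λ a u → proj₁ (proj₂ bil) a u w)

  φ-linearʳ : ∀ u → IsLinear (φ u)
  φ-linearʳ u = (λ v w → proj₁ (proj₂ (proj₂ bil)) u v w) , (λ a w → proj₂ (proj₂ (proj₂ bil)) a u w)

  -- An alternating bilinear map is antisymmetric:
  -- 0 = φ(a+b, a+b) = φ(a,a) + φ(a,b) + φ(b,a) + φ(b,b).
  φ-antisym : ∀ a b → φ b a ≡ -ᵥ φ a b
  φ-antisym a b = +ᵥ.inverseʳ-unique (φ a b) (φ b a) (begin
    φ a b +ᵥ φ b a                          ≡⟨ sym (cong₂ _+ᵥ_ (+ᵥ.identityˡ _) (+ᵥ.identityʳ _)) ⟩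
    (0ᵥ m +ᵥ φ a b) +ᵥ (φ b a +ᵥ 0ᵥ m)      ≡⟨ cong₂ (λ x y → (x +ᵥ φ a b) +ᵥ (φ b a +ᵥ y)) (sym (alt a)) (sym (alt b)) ⟩
    (φ a a +ᵥ φ a b) +ᵥ (φ b a +ᵥ φ b b)    ≡⟨ sym (cong₂ _+ᵥ_ (proj₁ (φ-linearʳ a) a b) (proj₁ (φ-linearʳ b) a b)) ⟩
    φ a (a +ᵥ b) +ᵥ φ b (a +ᵥ b)            ≡⟨ sym (proj₁ (φ-linearˡ (a +ᵥ b)) a b) ⟩
    φ (a +ᵥ b) (a +ᵥ b)                     ≡⟨ alt _ ⟩
    0ᵥ m                                    ∎)
    where open ≡-Reasoning

  bilinear-closure : ∀ {d e} {Z : V p m → Set} → IsSubspace p Z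
                   → (bs : Vec (V p n) d) (es : Vec (V p n) e) → (∀ i j → Z (φ (lookup bs i) (lookup es j)))
                   → ∀ u w → Span bs u → Span es w → Z (φ u w)
  bilinear-closure Zsub bs es orth u w u∈ w∈ =
    span⊆ (preimage-subspace Zsub (φ-linearˡ w))
      (lookup⁻ (λ i → span⊆ (preimage-subspace Zsub (φ-linearʳ (lookup bs i))) (lookup⁻ (orth i)) w w∈)) u u∈

  orthDecomp-from-bases : ∀ {d e} (bs : Vec (V p n) (suc d)) (es : Vec (V p n) (suc e)) (U : V p n → Set)
    {Z : V p m → Set} → IsSubspace p Z → Indep (bs ++ es) → (∀ i j → Z (φ (lookup bs i) (lookup es j)))
    → (∀ u → Span bs u → U u) → (∀ u → Span es u → U u) → (∀ u → U u → Span (bs ++ es) u)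
    → OrthDecomp p φ U Z
  orthDecomp-from-bases bs@(b ∷ bs') es@(e ∷ es') U Zsub ind orth bs⊆U es⊆U U⊆span =
    Span bs , Span es , span-subspace bs , span-subspace es ,
    (b , span-lookup bs zero , indep-head≢0 b bs' (indep-++ˡ bs es ind)) ,
    (e , span-lookup es zero , indep-head≢0 e es' (indep-++ʳ bs es ind)) ,
    bs⊆U , es⊆U , spans-disjoint bs es ind ,
    (λ u u∈U → span-split bs es u (U⊆span u u∈U)) ,
    bilinear-closure Zsub bs es orth

  -- The table of values of φ on all pairs from a family; it spans φ(⟨bs⟩, ⟨bs⟩).
  φ-table : ∀ {d} → Vec (V p n) d → Vec (V p m) (d * d)
  φ-table bs = map φ bs ⊛* bs

  φ-table-lookup : ∀ {d} (bs : Vec (V p n) d) i j → lookup (φ-table bs) (combine i j) ≡ φ (lookup bs i) (lookup bs j)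
  φ-table-lookup bs i j = trans (lookup-⊛* (map φ bs) bs i j) (cong (λ f → f (lookup bs j)) (lookup-map i φ bs))

  φ-table-entry : ∀ {d} (bs : Vec (V p n) d) k → ∃₂ λ i j → lookup (φ-table bs) k ≡ φ (lookup bs i) (lookup bs j)
  φ-table-entry {d} bs k with combine-surjective {d} {d} k
  ... | i , j , refl = i , j , φ-table-lookup bs i j

module GroupOfForm (p : ℕ) ⦃ _ : NonZero p ⦄ (p-prime : Prime p) (odd : p % 2 ≡ 1)
                   {n m : ℕ} (φ : Bil p n m) (bil : IsBilinear p φ) (alt : IsAlternating p φ) where

  open import Data.Nat using (_^_; _*_; _≤_; z≤n)
  open import Data.Nat.Properties using (≤-reflexive)
  open import Data.List using (List; []; _∷_; _++_; map; length; concatMap)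
  open import Data.List.Properties using (length-map)
  open import Data.List.Membership.Propositional using (_∈_; find; lose)
  open import Data.List.Membership.Propositional.Properties using (∈-map⁺; ∈-concat⁺′)
  open import Data.List.Relation.Unary.Any using (Any; any?)
  open import Data.List.Relation.Unary.All as All using (All; []; _∷_)
  open import Data.List.Relation.Unary.All.Properties using (++⁺)
  open import Data.Vec using (Vec; []; _∷_)
  open import Data.Fin using (zero; suc)
  open import Data.Product using (∃; _×_; _,_; proj₁; proj₂)
  open import Data.Sum using (_⊎_; inj₁; inj₂)
  open import Data.Unit using (⊤; tt)
  open import Data.Empty using (⊥-elim)
  open import Relation.Nullary using (Dec; yes; no)
  open import Relation.Binary.PropositionalEquality
  open import Defs using (F; V; half; IsSubspace; ImageSpans; Pcar; mulP; invP; eP; module GroupTheory)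
  import Algebra.Solver.CommutativeMonoid as CommutativeMonoidSolver

  open Forms p p-prime φ bil alt public
  open Enumeration using (covered-by-blocks)

  P : Set
  P = Pcar p n m

  infixl 7 _·_
  _·_ : P → P → P
  _·_ = mulP p φ

  ι : P → P
  ι = invP p

  ε : P
  ε = eP p

  open GroupTheory _·_ ι ε public

  private
    h : F p
    h = half p

    h·φ-0ʳ : ∀ v → h ·ᵥ φ v (0ᵥ n) ≡ 0ᵥ m
    h·φ-0ʳ v = trans (cong (h ·ᵥ_) (linear-0 (φ-linearʳ v))) (·ᵥ-zeroʳ h)

    h·φ-0ˡ : ∀ v → h ·ᵥ φ (0ᵥ n) v ≡ 0ᵥ m
    h·φ-0ˡ v = trans (cong (h ·ᵥ_) (linear-0 (φ-linearˡ v))) (·ᵥ-zeroʳ h)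

    h·φ-neg-self : ∀ v → h ·ᵥ φ (-ᵥ v) v ≡ 0ᵥ m
    h·φ-neg-self v = trans (cong (h ·ᵥ_) (trans (linear-neg (φ-linearˡ v) v) (trans (cong -ᵥ_ (alt v)) +ᵥ.ε⁻¹≈ε)))
                           (·ᵥ-zeroʳ h)

    module Solver = CommutativeMonoidSolver (+ᵥ.commutativeMonoid {m})

  ·-vertʳ : ∀ x (d : V p m) → x · (0ᵥ n , d) ≡ (proj₁ x , proj₂ x +ᵥ d)
  ·-vertʳ (v , s) d = cong₂ _,_ (+ᵥ.identityʳ v) (trans (cong ((s +ᵥ d) +ᵥ_) (h·φ-0ʳ v)) (+ᵥ.identityʳ _))

  ·-vertˡ : ∀ (d : V p m) x → (0ᵥ n , d) · x ≡ (proj₁ x , d +ᵥ proj₂ x)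
  ·-vertˡ d (v , s) = cong₂ _,_ (+ᵥ.identityˡ v) (trans (cong ((d +ᵥ s) +ᵥ_) (h·φ-0ˡ v)) (+ᵥ.identityʳ _))

  ·-identityˡ : ∀ x → ε · x ≡ x
  ·-identityˡ x = trans (·-vertˡ (0ᵥ m) x) (cong (proj₁ x ,_) (+ᵥ.identityˡ _))

  ·-identityʳ : ∀ x → x · ε ≡ x
  ·-identityʳ x = trans (·-vertʳ x (0ᵥ m)) (cong (proj₁ x ,_) (+ᵥ.identityʳ _))

  ·-orthogonal : ∀ u₁ u₂ (x y : V p m) → φ u₁ u₂ ≡ 0ᵥ m → (u₁ , x) · (u₂ , y) ≡ (u₁ +ᵥ u₂ , x +ᵥ y)
  ·-orthogonal u₁ u₂ x y φ≡0 =
    cong (u₁ +ᵥ u₂ ,_) (trans (cong (λ z → (x +ᵥ y) +ᵥ h ·ᵥ z) φ≡0) (trans (cong ((x +ᵥ y) +ᵥ_) (·ᵥ-zeroʳ h)) (+ᵥ.identityʳ _)))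

  ι-·-same : ∀ v (s t : V p m) → ι (v , s) · (v , t) ≡ (0ᵥ n , -ᵥ s +ᵥ t)
  ι-·-same v s t =
    cong₂ _,_ (+ᵥ.inverseˡ v) (trans (cong ((-ᵥ s +ᵥ t) +ᵥ_) (h·φ-neg-self v)) (+ᵥ.identityʳ _))

  ι-vert : ∀ (w : V p m) → ι (0ᵥ n , w) ≡ (0ᵥ n , -ᵥ w)
  ι-vert w = cong (_, -ᵥ w) +ᵥ.ε⁻¹≈ε

  vertical-quotient⇒same-first : ∀ x y → proj₁ (ι x · y) ≡ 0ᵥ n → proj₁ y ≡ proj₁ x
  vertical-quotient⇒same-first x y e = trans (+ᵥ.inverseʳ-unique (-ᵥ proj₁ x) (proj₁ y) e) (+ᵥ.⁻¹-involutive _)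

  vert-central : ∀ (d : V p m) x → (0ᵥ n , d) · x ≡ x · (0ᵥ n , d)
  vert-central d x = trans (·-vertˡ d x) (trans (cong (proj₁ x ,_) (+ᵥ.comm d _)) (sym (·-vertʳ x d)))

  ι-involutive : ∀ x → ι (ι x) ≡ x
  ι-involutive (v , s) = cong₂ _,_ (+ᵥ.⁻¹-involutive v) (+ᵥ.⁻¹-involutive s)

  ι-inverseˡ : ∀ x → ι x · x ≡ ε
  ι-inverseˡ (v , s) = trans (ι-·-same v s s) (cong (0ᵥ n ,_) (+ᵥ.inverseˡ s))

  ι-inverseʳ : ∀ x → x · ι x ≡ ε
  ι-inverseʳ x = trans (cong (_· ι x) (sym (ι-involutive x))) (ι-inverseˡ (ι x))

  ·-assoc : ∀ x y z → (x · y) · z ≡ x · (y · z)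
  ·-assoc (v₁ , u₁) (v₂ , u₂) (v₃ , u₃) = cong₂ _,_ (+ᵥ.assoc v₁ v₂ v₃) (begin
    (((u₁ +ᵥ u₂) +ᵥ A) +ᵥ u₃) +ᵥ h ·ᵥ φ (v₁ +ᵥ v₂) v₃
      ≡⟨ cong ((((u₁ +ᵥ u₂) +ᵥ A) +ᵥ u₃) +ᵥ_) (h·-additive (proj₁ (φ-linearˡ v₃) v₁ v₂)) ⟩
    (((u₁ +ᵥ u₂) +ᵥ A) +ᵥ u₃) +ᵥ (B +ᵥ C)
      ≡⟨ rearrange ⟩
    (u₁ +ᵥ ((u₂ +ᵥ u₃) +ᵥ C)) +ᵥ (A +ᵥ B)
      ≡⟨ cong ((u₁ +ᵥ ((u₂ +ᵥ u₃) +ᵥ C)) +ᵥ_) (sym (h·-additive (proj₁ (φ-linearʳ v₁) v₂ v₃))) ⟩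
    (u₁ +ᵥ ((u₂ +ᵥ u₃) +ᵥ C)) +ᵥ h ·ᵥ φ v₁ (v₂ +ᵥ v₃)   ∎)
    where
    open ≡-Reasoning
    A = h ·ᵥ φ v₁ v₂
    B = h ·ᵥ φ v₁ v₃
    C = h ·ᵥ φ v₂ v₃
    h·-additive : ∀ {z x y : V p m} → z ≡ x +ᵥ y → h ·ᵥ z ≡ h ·ᵥ x +ᵥ h ·ᵥ y
    h·-additive refl = ·ᵥ-distribˡ h _ _
    rearrange : (((u₁ +ᵥ u₂) +ᵥ A) +ᵥ u₃) +ᵥ (B +ᵥ C) ≡ (u₁ +ᵥ ((u₂ +ᵥ u₃) +ᵥ C)) +ᵥ (A +ᵥ B)
    rearrange = Solver.prove 6 ((((U₁ ⊞ U₂) ⊞ Aᵥ) ⊞ U₃) ⊞ (Bᵥ ⊞ Cᵥ)) ((U₁ ⊞ ((U₂ ⊞ U₃) ⊞ Cᵥ)) ⊞ (Aᵥ ⊞ Bᵥ))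
                             (u₁ ∷ u₂ ∷ u₃ ∷ A ∷ B ∷ C ∷ [])
      where
      open Solver using (var) renaming (_⊕_ to _⊞_)
      U₁ = var zero
      U₂ = var (suc zero)
      U₃ = var (suc (suc zero))
      Aᵥ = var (suc (suc (suc zero)))
      Bᵥ = var (suc (suc (suc (suc zero))))
      Cᵥ = var (suc (suc (suc (suc (suc zero)))))

  -- ι x · ι y = ι (y · x), using φ(-v,-w) = φ(v,w) = -φ(w,v).
  ι-anti : ∀ x y → ι x · ι y ≡ ι (y · x)
  ι-anti (v , s) (w , t) = cong₂ _,_ (trans (+ᵥ.comm _ _) (+ᵥ.⁻¹-∙-comm w v)) (begin
    (-ᵥ s +ᵥ -ᵥ t) +ᵥ h ·ᵥ φ (-ᵥ v) (-ᵥ w)    ≡⟨ cong (λ z → (-ᵥ s +ᵥ -ᵥ t) +ᵥ h ·ᵥ z) φ-neg-neg ⟩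
    (-ᵥ s +ᵥ -ᵥ t) +ᵥ h ·ᵥ φ v w              ≡⟨ cong (λ z → (-ᵥ s +ᵥ -ᵥ t) +ᵥ h ·ᵥ z) (φ-antisym w v) ⟩
    (-ᵥ s +ᵥ -ᵥ t) +ᵥ h ·ᵥ (-ᵥ φ w v)         ≡⟨ cong₂ _+ᵥ_ (trans (+ᵥ.comm _ _) (+ᵥ.⁻¹-∙-comm t s)) (·ᵥ-neg h _) ⟩
    -ᵥ (t +ᵥ s) +ᵥ -ᵥ (h ·ᵥ φ w v)            ≡⟨ +ᵥ.⁻¹-∙-comm _ _ ⟩
    -ᵥ ((t +ᵥ s) +ᵥ h ·ᵥ φ w v)               ∎)
    where
    open ≡-Reasoning
    φ-neg-neg : φ (-ᵥ v) (-ᵥ w) ≡ φ v w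
    φ-neg-neg = trans (linear-neg (φ-linearˡ (-ᵥ w)) v)
                 (trans (cong -ᵥ_ (linear-neg (φ-linearʳ v) w)) (+ᵥ.⁻¹-involutive _))

  commutation-defect : ∀ x y → ι (x · y) · (y · x) ≡ (0ᵥ n , φ (proj₁ y) (proj₁ x))
  commutation-defect (a , s) (b , t) = begin
    ι (a +ᵥ b , σ) · (b +ᵥ a , τ)    ≡⟨ cong (λ c → ι (a +ᵥ b , σ) · (c , τ)) (+ᵥ.comm b a) ⟩
    ι (a +ᵥ b , σ) · (a +ᵥ b , τ)    ≡⟨ ι-·-same (a +ᵥ b) σ τ ⟩
    (0ᵥ n , -ᵥ σ +ᵥ τ)               ≡⟨ cong (0ᵥ n ,_) -σ+τ≡φba ⟩
    (0ᵥ n , φ b a)                   ∎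
    where
    open ≡-Reasoning
    σ = (s +ᵥ t) +ᵥ h ·ᵥ φ a b
    τ = (t +ᵥ s) +ᵥ h ·ᵥ φ b a
    -σ+τ≡φba : -ᵥ σ +ᵥ τ ≡ φ b a
    -σ+τ≡φba = begin
      -ᵥ σ +ᵥ τ
        ≡⟨ cong₂ _+ᵥ_ (sym (+ᵥ.⁻¹-∙-comm _ _)) (cong (_+ᵥ h ·ᵥ φ b a) (+ᵥ.comm t s)) ⟩
      (-ᵥ (s +ᵥ t) +ᵥ -ᵥ (h ·ᵥ φ a b)) +ᵥ ((s +ᵥ t) +ᵥ h ·ᵥ φ b a)
        ≡⟨ +ᵥ.interchange _ _ _ _ ⟩
      (-ᵥ (s +ᵥ t) +ᵥ (s +ᵥ t)) +ᵥ (-ᵥ (h ·ᵥ φ a b) +ᵥ h ·ᵥ φ b a)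
        ≡⟨ cong (_+ᵥ (-ᵥ (h ·ᵥ φ a b) +ᵥ h ·ᵥ φ b a)) (+ᵥ.inverseˡ _) ⟩
      0ᵥ m +ᵥ (-ᵥ (h ·ᵥ φ a b) +ᵥ h ·ᵥ φ b a)
        ≡⟨ +ᵥ.identityˡ _ ⟩
      -ᵥ (h ·ᵥ φ a b) +ᵥ h ·ᵥ φ b a
        ≡⟨ cong (_+ᵥ h ·ᵥ φ b a) (trans (sym (·ᵥ-neg h _)) (cong (h ·ᵥ_) (sym (φ-antisym a b)))) ⟩
      h ·ᵥ φ b a +ᵥ h ·ᵥ φ b a
        ≡⟨ halves odd _ ⟩
      φ b a
        ∎

  commutator-formula : ∀ x y → comm x y ≡ (0ᵥ n , φ (proj₁ x) (proj₁ y))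
  commutator-formula x y = begin
    ((ι x · ι y) · x) · y    ≡⟨ cong (λ z → (z · x) · y) (ι-anti x y) ⟩
    (ι (y · x) · x) · y      ≡⟨ ·-assoc _ x y ⟩
    ι (y · x) · (x · y)      ≡⟨ commutation-defect y x ⟩
    (0ᵥ n , φ (proj₁ x) (proj₁ y)) ∎
    where open ≡-Reasoning

  commute⇒orthogonal : ∀ x y → x · y ≡ y · x → φ (proj₁ x) (proj₁ y) ≡ 0ᵥ m
  commute⇒orthogonal x y xy≡yx = cong proj₂ (begin
    (0ᵥ n , φ (proj₁ x) (proj₁ y))   ≡⟨ sym (commutation-defect y x) ⟩
    ι (y · x) · (x · y)              ≡⟨ cong (ι (y · x) ·_) xy≡yx ⟩
    ι (y · x) · (y · x)              ≡⟨ ι-inverseˡ _ ⟩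
    ε                                ∎)
    where open ≡-Reasoning

  Gen-induction : ∀ (G R : P → Set) → R ε → (∀ x y → R x → R y → R (x · y))
                → (∀ y → G y → R y) → (∀ y → G (ι y) → R y) → ∀ x → Gen G x → R x
  Gen-induction G R Rε R· RG RGι x (ys , gens , refl) = go ys gens
    where
    go : ∀ ys → All (λ y → G y ⊎ G (ι y)) ys → R (prodList ys)
    go [] [] = Rε
    go (y ∷ ys) (inj₁ g ∷ gs) = R· _ _ (RG y g) (go ys gs)
    go (y ∷ ys) (inj₂ g ∷ gs) = R· _ _ (RGι y g) (go ys gs)

  prodList-++ : ∀ xs ys → prodList (xs ++ ys) ≡ prodList xs · prodList ys
  prodList-++ [] ys = sym (·-identityˡ _)
  prodList-++ (x ∷ xs) ys = trans (cong (x ·_) (prodList-++ xs ys)) (sym (·-assoc x _ _))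

  Gen-· : ∀ {G} x y → Gen G x → Gen G y → Gen G (x · y)
  Gen-· _ _ (xs , gx , refl) (ys , gy , refl) = xs ++ ys , ++⁺ gx gy , prodList-++ xs ys

  Vertical : (V p m → Set) → P → Set
  Vertical W x = proj₁ x ≡ 0ᵥ n × W (proj₂ x)

  derived⊆vertical : ∀ (Q : P → Set) {W : V p m → Set} → IsSubspace p W
                   → (∀ a b → Q a → Q b → W (φ (proj₁ a) (proj₁ b))) → ∀ x → Derived Q x → Vertical W x
  derived⊆vertical Q {W} Wsub@(W0 , W+ , _) φQQ⊆W = Gen-induction (Commutators Q) (Vertical W) (refl , W0) closed gen gen⁻¹
    where
    closed : ∀ x y → Vertical W x → Vertical W y → Vertical W (x · y)
    closed (.(0ᵥ n) , s) y (refl , ws) (y₁≡0 , wy) = subst (Vertical W) (sym (·-vertˡ s y)) (y₁≡0 , W+ _ _ ws wy)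
    gen : ∀ y → Commutators Q y → Vertical W y
    gen y (a , b , qa , qb , refl) = subst (Vertical W) (sym (commutator-formula a b)) (refl , φQQ⊆W a b qa qb)
    gen⁻¹ : ∀ y → Commutators Q (ι y) → Vertical W y
    gen⁻¹ y (a , b , qa , qb , [a,b]≡ιy) = subst (Vertical W) y≡ (refl , subspace-neg Wsub _ (φQQ⊆W a b qa qb))
      where
      y≡ : (0ᵥ n , -ᵥ φ (proj₁ a) (proj₁ b)) ≡ y
      y≡ = trans (sym (ι-vert _)) (trans (cong ι (trans (sym (commutator-formula a b)) [a,b]≡ιy)) (ι-involutive y))

  derived-vertical : ∀ Q x → Derived Q x → proj₁ x ≡ 0ᵥ n
  derived-vertical Q x d = proj₁ (derived⊆vertical Q {λ _ → ⊤} (tt , (λ _ _ _ _ → tt) , (λ _ _ _ → tt)) (λ _ _ _ _ → tt) x d)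

  DerivedVertical : (P → Set) → V p m → Set
  DerivedVertical Q w = Derived Q (0ᵥ n , w)

  derivedVertical-subspace : ∀ Q → IsSubspace p (DerivedVertical Q)
  derivedVertical-subspace Q = ([] , [] , refl) , closed+ , additive⇒scalar-closed _ ([] , [] , refl) closed+
    where
    closed+ : ∀ u v → DerivedVertical Q u → DerivedVertical Q v → DerivedVertical Q (u +ᵥ v)
    closed+ u v du dv = subst (Derived Q) (·-vertˡ u (0ᵥ n , v)) (Gen-· _ _ du dv)

  φ∈derivedVertical : ∀ Q a b → Q a → Q b → DerivedVertical Q (φ (proj₁ a) (proj₁ b))
  φ∈derivedVertical Q a b qa qb = subst (Derived Q) (trans (·-identityʳ _) (commutator-formula a b))
    (comm a b ∷ [] , inj₁ (a , b , qa , qb , refl) ∷ [] , refl)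

  Img : (P → Set) → V p n → Set
  Img H v = ∃ λ x → H (v , x)

  image-subspace : ∀ H → IsSubgroup H → IsSubspace p (Img H)
  image-subspace H (Hε , H· , _) = (_ , Hε) , closed+ , additive⇒scalar-closed (Img H) (_ , Hε) closed+
    where
    closed+ : ∀ u v → Img H u → Img H v → Img H (u +ᵥ v)
    closed+ u v (s , hu) (t , hv) = _ , H· _ _ hu hv

  derived⊆subgroup : ∀ Q H → IsSubgroup H → (∀ a → Q a → Img H (proj₁ a)) → ∀ x → Derived Q x → H x
  derived⊆subgroup Q H (Hε , H· , Hι) overH = Gen-induction (Commutators Q) H Hε H· gen gen⁻¹
    where
    gen : ∀ y → Commutators Q y → H y
    gen y (a , b , qa , qb , refl) with overH a qa | overH b qb
    ... | s , ha | t , hb = subst H (trans (commutator-formula _ _) (sym (commutator-formula a b)))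
                              (H· _ _ (H· _ _ (H· _ _ (Hι _ ha) (Hι _ hb)) ha) hb)
    gen⁻¹ : ∀ y → Commutators Q (ι y) → H y
    gen⁻¹ y c = subst H (ι-involutive y) (Hι _ (gen (ι y) c))

  derived-card-nonZero : ∀ Q {k} → HasCard (Derived Q) k → NonZero k
  derived-card-nonZero Q ([] , refl , _ , memD) with proj₁ (memD ε) ([] , [] , refl)
  ... | ()
  derived-card-nonZero Q (_ ∷ _ , refl , _) = _

  whole-regular : Regular Whole
  whole-regular x = (λ d → tt , d) , proj₂

  module _ (spans : ImageSpans p φ) where

    derived-whole : ∀ w → Derived Whole (0ᵥ n , w)
    derived-whole w with spans w
    ... | xs , inImage , refl = sumList-closed (derivedVertical-subspace Whole)
      (All.map (λ { (u , v , refl) → φ∈derivedVertical Whole (u , 0ᵥ m) (v , 0ᵥ m) tt tt }) inImage)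

    derived⊆derived-whole : ∀ Q x → Derived Q x → Derived Whole x
    derived⊆derived-whole Q (v , w) d with derived-vertical Q _ d
    ... | refl = derived-whole w

    -- A subgroup H of a regular subgroup S containing elements over every
    -- first coordinate of S is all of S: it contains [S,S] = S ∩ (0 ⊕ 𝔽ₚᵐ).
    image-saturated : ∀ S H → IsSubgroup S → Regular S → IsSubgroup H → (∀ x → H x → S x)
                    → (∀ v → Img S v → Img H v) → ∀ x → S x → H x
    image-saturated S H (_ , S· , Sι) regular Hsub@(_ , H· , _) H⊆S imgS⊆imgH (v , t) st
      with imgS⊆imgH v (t , st)
    ... | s , hs = subst H (trans (·-vertʳ (v , s) _) (cong (v ,_) (+ᵥ.\\-leftDividesˡ s t))) (H· _ _ hs hz)
      where
      z∈S : S (0ᵥ n , -ᵥ s +ᵥ t)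
      z∈S = subst S (ι-·-same v s t) (S· _ _ (Sι _ (H⊆S _ hs)) st)
      hz : H (0ᵥ n , -ᵥ s +ᵥ t)
      hz = derived⊆subgroup S H Hsub (λ a sa → imgS⊆imgH (proj₁ a) (proj₂ a , sa)) _
             (proj₂ (regular _) (z∈S , derived-whole _))

    same-fibre⇒derived : ∀ S → IsSubgroup S → Regular S → ∀ t x → S t → S x → proj₁ t ≡ proj₁ x → Derived S (ι t · x)
    same-fibre⇒derived S (_ , S· , Sι) regular (v , s) (.v , u) st sx refl =
      proj₂ (regular _) (S· _ _ (Sι _ st) sx , subst (Derived Whole) (sym (ι-·-same v s u)) (derived-whole _))

    -- Hence |S| ≤ pʳ · |[S, S]| when r vectors span the first coordinates of S:
    -- S is covered by the cosets t·[S,S], one for each linear combination.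
    regular-card-bound : ∀ S → IsSubgroup S → Regular S → ∀ {k l} → HasCard (Derived S) k → HasCard S l
                       → ∀ {r} (ws : Vec (V p n) r) → (∀ v → Img S v → Span ws v) → l ≤ p ^ r * k
    regular-card-bound S Ssub regular {k} (Dlist , lenD , _ , memD) (Slist , lenS , uniqueS , memS) {r} ws spanning =
      subst₂ _≤_ lenS (cong (_* k) (length-vectors r)) (covered-by-blocks block (vectors r) k uniqueS covered block-size)
      where
      Over : Vec (F p) r → P → Set
      Over cs t = proj₁ t ≡ lc cs ws

      coset : ∀ cs → Dec (Any (Over cs) Slist) → List P
      coset cs (yes some) = map (proj₁ (find some) ·_) Dlist
      coset cs (no _) = []

      block : Vec (F p) r → List P
      block cs = coset cs (any? (λ t → proj₁ t ≟ᵥ lc cs ws) Slist)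

      block-size : ∀ cs → length (block cs) ≤ k
      block-size cs with any? (λ t → proj₁ t ≟ᵥ lc cs ws) Slist
      ... | yes _ = ≤-reflexive (trans (length-map _ Dlist) lenD)
      ... | no _ = z≤n

      in-block : ∀ cs x → x ∈ Slist → Over cs x → x ∈ block cs
      in-block cs x x∈ over with any? (λ t → proj₁ t ≟ᵥ lc cs ws) Slist
      ... | no none = ⊥-elim (none (lose x∈ over))
      ... | yes some with find some
      ...   | t , t∈ , t-over = subst (_∈ map (t ·_) Dlist) t·t⁻¹x≡x (∈-map⁺ (t ·_) (proj₁ (memD _) t⁻¹x∈D))
        where
        t⁻¹x∈D : Derived S (ι t · x)
        t⁻¹x∈D = same-fibre⇒derived S Ssub regular t x (proj₂ (memS t) t∈) (proj₂ (memS x) x∈) (trans t-over (sym over))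
        t·t⁻¹x≡x : t · (ι t · x) ≡ x
        t·t⁻¹x≡x = trans (sym (·-assoc t (ι t) x)) (trans (cong (_· x) (ι-inverseʳ t)) (·-identityˡ x))

      covered : ∀ {x} → x ∈ Slist → x ∈ concatMap block (vectors r)
      covered {x} x∈ with spanning (proj₁ x) (proj₂ x , proj₂ (memS x) x∈)
      ... | cs , lc≡ = ∈-concat⁺′ (in-block cs x x∈ (sym lc≡)) (∈-map⁺ block (vectors-complete cs))

-- κ(P_φ) ≤ κ(φ): decompositions of restrictions φ|_U give regular subgroups.
module RestrictionToSubgroup (p : ℕ) ⦃ _ : NonZero p ⦄ (p-prime : Prime p) (odd : p % 2 ≡ 1)
    {n m : ℕ} (φ : Bil p n m) (bil : IsBilinear p φ) (alt : IsAlternating p φ) (spans : ImageSpans p φ) where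

  open import Data.Nat using (_*_; _^_)
  open import Data.List using (List; length; map; filter; cartesianProductWith)
  open import Data.List.Properties using (length-map)
  open import Data.List.Membership.Propositional using (_∈_)
  open import Data.List.Membership.Propositional.Properties
    using (∈-map⁺; ∈-map⁻; ∈-filter⁺; ∈-filter⁻; ∈-cartesianProductWith⁺; ∈-cartesianProductWith⁻)
  open import Data.List.Relation.Unary.Unique.Propositional.Properties using (map⁺; filter⁺; cartesianProductWith⁺)
  open import Data.Vec using (Vec; lookup)
  open import Data.Vec.Relation.Unary.All.Properties using (lookup⁻)
  open import Data.Fin using (combine)
  open import Data.Product using (∃; _×_; _,_; proj₁; proj₂)
  open import Data.Product.Properties using (,-injectiveˡ; ,-injectiveʳ)
  open import Relation.Binary.PropositionalEquality
  open import Defs using (V; half; IsSubspace; OrthDecomp; κφ-cand; κP-cand)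
  open Enumeration using (length-cartesianProductWith)

  open GroupOfForm p p-prime odd φ bil alt

  module OverBasis {d} {U : V p n → Set} (Usub : IsSubspace p U) (bs : Vec (V p n) d) (indep : Indep bs)
           (inU : ∀ i → U (lookup bs i)) (U⊆span : ∀ v → U v → Span bs v) where

    -- W = ⟨φ(U, U)⟩, spanned by the values of φ on pairs of basis vectors.
    W : V p m → Set
    W = Span (φ-table bs)

    private
      W0 = proj₁ (span-subspace (φ-table bs))
      W+ = proj₁ (proj₂ (span-subspace (φ-table bs)))
      W· = proj₂ (proj₂ (span-subspace (φ-table bs)))

    φUU⊆W : ∀ u u' → U u → U u' → W (φ u u')
    φUU⊆W u u' uu uu' = bilinear-closure (span-subspace (φ-table bs)) bs bs
      (λ i j → subst W (φ-table-lookup bs i j) (span-lookup (φ-table bs) (combine i j)))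
      u u' (U⊆span u uu) (U⊆span u' uu')

    _⊕W : (V p n → Set) → P → Set
    (T ⊕W) x = T (proj₁ x) × W (proj₂ x)

    ⊕W-subgroup : ∀ {T} → IsSubspace p T → (∀ u → T u → U u) → IsSubgroup (T ⊕W)
    ⊕W-subgroup {T} Tsub@(T0 , T+ , _) T⊆U = (T0 , W0) , closed· , closedι
      where
      closed· : ∀ x y → (T ⊕W) x → (T ⊕W) y → (T ⊕W) (x · y)
      closed· (v , x) (w , y) (tv , wx) (tw , wy) =
        T+ v w tv tw , W+ _ _ (W+ x y wx wy) (W· (half p) _ (φUU⊆W v w (T⊆U v tv) (T⊆U w tw)))
      closedι : ∀ x → (T ⊕W) x → (T ⊕W) (ι x)
      closedι (v , x) (tv , wx) = subspace-neg Tsub v tv , subspace-neg (span-subspace (φ-table bs)) x wx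

    S : P → Set
    S = U ⊕W

    S-subgroup : IsSubgroup S
    S-subgroup = ⊕W-subgroup Usub (λ _ u → u)

    derived⊆ : ∀ x → Derived S x → Vertical W x
    derived⊆ = derived⊆vertical S (span-subspace (φ-table bs)) (λ a b sa sb → φUU⊆W _ _ (proj₁ sa) (proj₁ sb))

    ⊆derived : ∀ w → W w → Derived S (0ᵥ n , w)
    ⊆derived = span⊆ (derivedVertical-subspace S) (lookup⁻ table⊆derived)
      where
      table⊆derived : ∀ k → DerivedVertical S (lookup (φ-table bs) k)
      table⊆derived k with φ-table-entry bs k
      ... | i , j , entry≡ = subst (DerivedVertical S) (sym entry≡)
        (φ∈derivedVertical S (lookup bs i , 0ᵥ m) (lookup bs j , 0ᵥ m) (inU i , W0) (inU j , W0))

    -- S is regular: [S, S] = S ∩ [P, P], since both equal 0 ⊕ W.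
    S-regular : Regular S
    S-regular x = derived⇒S∩P' , S∩P'⇒derived
      where
      derived⇒S∩P' : Derived S x → S x × Derived Whole x
      derived⇒S∩P' dx with derived⊆ x dx
      ... | x₁≡0 , wx = (subst U (sym x₁≡0) (proj₁ Usub) , wx) , derived⊆derived-whole spans S x dx
      S∩P'⇒derived : S x × Derived Whole x → Derived S x
      S∩P'⇒derived ((_ , wx) , dx) = subst (Derived S) (cong (_, proj₂ x) (sym (derived-vertical Whole x dx))) (⊆derived _ wx)

    Wlist : List (V p m)
    Wlist = filter (span? (φ-table bs)) (vectors m)

    private
      W⇒∈ : ∀ w → W w → w ∈ Wlist
      W⇒∈ w ww = ∈-filter⁺ (span? (φ-table bs)) (vectors-complete w) ww
      ∈⇒W : ∀ w → w ∈ Wlist → W w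
      ∈⇒W w w∈ = proj₂ (∈-filter⁻ (span? (φ-table bs)) {xs = vectors m} w∈)
      Wlist-unique = filter⁺ (span? (φ-table bs)) {vectors m} (vectors-unique m)

    derived-card : HasCard (Derived S) (length Wlist)
    derived-card = map (0ᵥ n ,_) Wlist , length-map _ Wlist , map⁺ ,-injectiveʳ Wlist-unique , member
      where
      member : ∀ x → (Derived S x → x ∈ map (0ᵥ n ,_) Wlist) × (x ∈ map (0ᵥ n ,_) Wlist → Derived S x)
      member x = (λ dx → let (x₁≡0 , wx) = derived⊆ x dx in
                          subst (_∈ _) (cong (_, proj₂ x) (sym x₁≡0)) (∈-map⁺ _ (W⇒∈ _ wx))) ,
                 (λ x∈ → let (w , w∈ , x≡) = ∈-map⁻ _ x∈ in subst (Derived S) (sym x≡) (⊆derived w (∈⇒W w w∈)))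

    S-card : HasCard S (p ^ d * length Wlist)
    S-card = Slist , trans (length-cartesianProductWith _,_ (spanList bs) Wlist) (cong (_* length Wlist) (length-spanList bs)) ,
             cartesianProductWith⁺ _,_ (λ e → ,-injectiveˡ e , ,-injectiveʳ e) (spanList-unique bs indep) Wlist-unique , member
      where
      Slist = cartesianProductWith _,_ (spanList bs) Wlist
      member : ∀ x → (S x → x ∈ Slist) × (x ∈ Slist → S x)
      member (v , w) = (λ (uv , ww) → ∈-cartesianProductWith⁺ _,_ (span⇒∈spanList bs v (U⊆span v uv)) (W⇒∈ w ww)) ,
                       (λ x∈ → let (a , b , a∈ , b∈ , x≡) = ∈-cartesianProductWith⁻ _,_ (spanList bs) Wlist x∈ in
                         subst S (sym x≡) (span⊆ Usub (lookup⁻ inU) a (∈spanList⇒span bs a a∈) , ∈⇒W b b∈))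

    central-decomposition : OrthDecomp p φ U (_≡ 0ᵥ m) → CentralDecomp _≡_ S
    central-decomposition (U₁ , U₂ , U₁sub , U₂sub , (u₁ , u₁∈ , u₁≢0) , (u₂ , u₂∈ , u₂≢0) , U₁⊆U , U₂⊆U , disjoint , cover , orth) =
      U₁ ⊕W , U₂ ⊕W , ⊕W-subgroup U₁sub U₁⊆U , ⊕W-subgroup U₂sub U₂⊆U ,
      (λ x y x≡y jx → subst (U₁ ⊕W) x≡y jx) , (λ x y x≡y kx → subst (U₂ ⊕W) x≡y kx) ,
      (λ (v , x) (uv , wx) → U₁⊆U v uv , wx) , (λ (v , x) (uv , wx) → U₂⊆U v uv , wx) ,
      ((u₁ , 0ᵥ m) , (u₁∈ , W0) , (λ e → u₁≢0 (cong proj₁ e))) ,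
      ((u₂ , 0ᵥ m) , (u₂∈ , W0) , (λ e → u₂≢0 (cong proj₁ e))) ,
      ((u₂ , 0ᵥ m) , (U₂⊆U _ u₂∈ , W0) , (λ j → u₂≢0 (disjoint _ (proj₁ j) u₂∈))) ,
      ((u₁ , 0ᵥ m) , (U₁⊆U _ u₁∈ , W0) , (λ k → u₁≢0 (disjoint _ u₁∈ (proj₁ k)))) ,
      commute , factor
      where
      commute : ∀ j k → (U₁ ⊕W) j → (U₂ ⊕W) k → j · k ≡ k · j
      commute (a , x) (b , y) (ja , _) (kb , _) = begin
        (a , x) · (b , y)       ≡⟨ ·-orthogonal a b x y (orth a b ja kb) ⟩
        (a +ᵥ b , x +ᵥ y)       ≡⟨ cong₂ _,_ (+ᵥ.comm a b) (+ᵥ.comm x y) ⟩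
        (b +ᵥ a , y +ᵥ x)       ≡⟨ sym (·-orthogonal b a y x (trans (φ-antisym a b) (trans (cong -ᵥ_ (orth a b ja kb)) +ᵥ.ε⁻¹≈ε))) ⟩
        (b , y) · (a , x)       ∎
        where open ≡-Reasoning
      factor : ∀ h → S h → ∃ λ j → ∃ λ k → (U₁ ⊕W) j × (U₂ ⊕W) k × h ≡ j · k
      factor (v , x) (uv , wx) with cover v uv
      ... | v₁ , v₂ , v₁∈ , v₂∈ , v≡ = (v₁ , x) , (v₂ , 0ᵥ m) , (v₁∈ , wx) , (v₂∈ , W0) ,
        trans (cong₂ _,_ v≡ (sym (+ᵥ.identityʳ x))) (sym (·-orthogonal v₁ v₂ x (0ᵥ m) (orth v₁ v₂ v₁∈ v₂∈)))

  κφ⇒κP : ∀ c → κφ-cand p φ c → κP-cand p φ c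
  κφ⇒κP c (c≤n , U , Usub , (bs , indep , inU , U⊆span) , decomposition) =
    c≤n , S , S-subgroup , S-regular , (_ , derived-card , S-card) , central-decomposition decomposition
    where open OverBasis Usub bs indep inU U⊆span

-- λ(P_φ) ≤ λ(φ): decompositions of quotients φ/X give decompositions of P_φ/(0 ⊕ X).
module QuotientToCentral (p : ℕ) ⦃ _ : NonZero p ⦄ (p-prime : Prime p) (odd : p % 2 ≡ 1)
    {n m : ℕ} (φ : Bil p n m) (bil : IsBilinear p φ) (alt : IsAlternating p φ) where

  open import Data.Nat using (_^_)
  open import Data.List using (map)
  open import Data.List.Properties using (length-map)
  open import Data.List.Membership.Propositional using (_∈_)
  open import Data.List.Membership.Propositional.Properties using (∈-map⁺; ∈-map⁻)
  open import Data.List.Relation.Unary.Unique.Propositional.Properties using (map⁺)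
  open import Data.Vec using (Vec; lookup)
  open import Data.Vec.Relation.Unary.All.Properties using (lookup⁻)
  open import Data.Product using (∃; _×_; _,_; proj₁; proj₂)
  open import Data.Product.Properties using (,-injectiveʳ)
  open import Data.Unit using (tt)
  open import Relation.Nullary using (¬_)
  open import Relation.Binary.PropositionalEquality
  open import Defs using (V; half; IsSubspace; OrthDecomp; FullSpace; λφ-cand; λP-cand)

  open GroupOfForm p p-prime odd φ bil alt

  module OverBasis {c} {X : V p m → Set} (Xsub : IsSubspace p X) (xs : Vec (V p m) c) (indep : Indep xs)
                   (inX : ∀ i → X (lookup xs i)) (X⊆span : ∀ v → X v → Span xs v) where

    N : P → Set
    N = Vertical X

    N-subgroup : IsSubgroup N
    N-subgroup = (refl , proj₁ Xsub) , closed· , closedι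
      where
      closed· : ∀ x y → N x → N y → N (x · y)
      closed· (.(0ᵥ n) , s) y (refl , xs') (y₁≡0 , xt) = subst N (sym (·-vertˡ s y)) (y₁≡0 , proj₁ (proj₂ Xsub) _ _ xs' xt)
      closedι : ∀ x → N x → N (ι x)
      closedι (.(0ᵥ n) , s) (refl , xs') = subst N (sym (ι-vert s)) (refl , subspace-neg Xsub s xs')

    N-central : Central N
    N-central (.(0ᵥ n) , s) y (refl , _) = vert-central s y

    N-card : HasCard N (p ^ c)
    N-card = Nlist , trans (length-map _ (spanList xs)) (length-spanList xs) , map⁺ ,-injectiveʳ (spanList-unique xs indep) , member
      where
      Nlist = map (0ᵥ n ,_) (spanList xs)
      member : ∀ x → (N x → x ∈ Nlist) × (x ∈ Nlist → N x)
      member (v , s) = (λ { (refl , xs') → ∈-map⁺ _ (span⇒∈spanList xs s (X⊆span s xs')) }) ,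
                       (λ x∈ → let (y , y∈ , x≡) = ∈-map⁻ _ x∈ in
                         subst N (sym x≡) (refl , span⊆ Xsub (lookup⁻ inX) y (∈spanList⇒span xs y y∈)))

    _~_ : P → P → Set
    x ~ y = N (ι x · y)

    ~⇒same-first : ∀ x y → x ~ y → proj₁ y ≡ proj₁ x
    ~⇒same-first x y (first≡0 , _) = vertical-quotient⇒same-first x y first≡0

    Lift : (V p n → Set) → P → Set
    Lift T x = T (proj₁ x)

    lift-subgroup : ∀ {T} → IsSubspace p T → IsSubgroup (Lift T)
    lift-subgroup Tsub@(T0 , T+ , _) = T0 , (λ x y tx ty → T+ _ _ tx ty) , (λ x tx → subspace-neg Tsub _ tx)

    lift-respects : ∀ T → Respects _~_ (Lift T)
    lift-respects T x y x~y tx = subst T (sym (~⇒same-first x y x~y)) tx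

    nonzero⇒≁ε : ∀ v → ¬ (v ≡ 0ᵥ n) → ¬ ((v , 0ᵥ m) ~ ε)
    nonzero⇒≁ε v v≢0 (first≡0 , _) = v≢0 (sym (vertical-quotient⇒same-first (v , 0ᵥ m) ε first≡0))

    central-decomposition : OrthDecomp p φ (FullSpace p) X → CentralDecomp _~_ Whole
    central-decomposition (U₁ , U₂ , U₁sub , U₂sub , (u₁ , u₁∈ , u₁≢0) , (u₂ , u₂∈ , u₂≢0) , _ , _ , disjoint , cover , orth) =
      Lift U₁ , Lift U₂ , lift-subgroup U₁sub , lift-subgroup U₂sub , lift-respects U₁ , lift-respects U₂ ,
      (λ _ _ → tt) , (λ _ _ → tt) ,
      ((u₁ , 0ᵥ m) , u₁∈ , nonzero⇒≁ε u₁ u₁≢0) , ((u₂ , 0ᵥ m) , u₂∈ , nonzero⇒≁ε u₂ u₂≢0) ,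
      ((u₂ , 0ᵥ m) , tt , (λ j → u₂≢0 (disjoint _ j u₂∈))) , ((u₁ , 0ᵥ m) , tt , (λ k → u₁≢0 (disjoint _ u₁∈ k))) ,
      commute , factor
      where
      -- (jk)⁻¹(kj) = (0, φ(k₁, j₁)) ∈ N
      commute : ∀ j k → Lift U₁ j → Lift U₂ k → (j · k) ~ (k · j)
      commute j k j∈ k∈ = subst N (sym (commutation-defect j k))
        (refl , subst X (sym (φ-antisym (proj₁ j) (proj₁ k))) (subspace-neg Xsub _ (orth _ _ j∈ k∈)))
      factor : ∀ h → Whole h → ∃ λ j → ∃ λ k → Lift U₁ j × Lift U₂ k × h ~ (j · k)
      factor (v , x) _ with cover v tt
      ... | v₁ , v₂ , v₁∈ , v₂∈ , refl = (v₁ , x) , (v₂ , 0ᵥ m) , v₁∈ , v₂∈ ,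
        subst N (sym (ι-·-same (v₁ +ᵥ v₂) x _)) (refl , subst X (sym x-cancels) (proj₂ (proj₂ Xsub) (half p) _ (orth v₁ v₂ v₁∈ v₂∈)))
        where
        x-cancels : -ᵥ x +ᵥ ((x +ᵥ 0ᵥ m) +ᵥ half p ·ᵥ φ v₁ v₂) ≡ half p ·ᵥ φ v₁ v₂
        x-cancels = trans (cong (λ z → -ᵥ x +ᵥ (z +ᵥ half p ·ᵥ φ v₁ v₂)) (+ᵥ.identityʳ x)) (+ᵥ.\\-leftDividesʳ x _)

  λφ⇒λP : ∀ c → λφ-cand p φ c → λP-cand p φ c
  λφ⇒λP c (X , Xsub , (xs , indep , inX , X⊆span) , decomposition) =
    N , N-subgroup , N-central , N-card , central-decomposition decomposition
    where open OverBasis Xsub xs indep inX X⊆span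

-- κ(φ) ≤ κ(P_φ): central decompositions of regular subgroups give decompositions of restrictions.
module SubgroupToRestriction (p : ℕ) ⦃ _ : NonZero p ⦄ (p-prime : Prime p) (odd : p % 2 ≡ 1)
    {n m : ℕ} (φ : Bil p n m) (bil : IsBilinear p φ) (alt : IsAlternating p φ) (spans : ImageSpans p φ) where

  open import Data.Nat using (suc; _+_; _*_; _∸_; _^_; _≤_; _≤?_)
  open import Data.Nat.Properties using (≤-trans; +-monoʳ-≤; +-comm; m≤n+m∸n; m≤n+o⇒m∸n≤o; m∸n≤m; m∸[m∸n]≡n; *-cancelʳ-≤)
  open import Data.List.Relation.Unary.All using (All)
  open import Data.Vec using (Vec; _++_; lookup)
  open import Data.Vec.Relation.Unary.All.Properties using (lookup⁺)
  open import Data.Fin using (toℕ)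
  open import Data.Fin.Properties using (all?)
  open import Data.Product using (∃; ∃₂; _×_; _,_; proj₁)
  open import Relation.Nullary using (¬_; Dec)
  open import Relation.Nullary.Decidable using (_×-dec_; decidable-stable)
  open import Relation.Binary.PropositionalEquality
  open import Defs using (V; HasDim; κφ-cand; κP-cand)

  open GroupOfForm p p-prime odd φ bil alt
  open Enumeration using (¬¬-decide-all)

  -- A finite certificate that κ(φ) ≤ s: non-empty families es, fs, jointly
  -- independent, with φ(fs, es) = 0 and at least n ∸ s members in total.
  KappaCondition : ℕ → ∀ {a b} → Vec (V p n) (suc a) → Vec (V p n) (suc b) → Set
  KappaCondition s {a} {b} es fs = (∀ i j → φ (lookup fs i) (lookup es j) ≡ 0ᵥ m) × n ∸ s ≤ suc b + suc a

  KappaCertificate : ℕ → Set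
  KappaCertificate s = IndepPair (KappaCondition s)

  kappaCertificate? : ∀ s → Dec (KappaCertificate s)
  kappaCertificate? s = indepPair? λ {a} {b} es fs →
    all? (λ i → all? (λ j → φ (lookup fs i) (lookup es j) ≟ᵥ 0ᵥ m)) ×-dec (n ∸ s ≤? suc b + suc a)

  certificate⇒κφ : ∀ s → KappaCertificate s → ∃ λ c → c ≤ s × κφ-cand p φ c
  certificate⇒κφ s (a , b , es , fs , indep , orth , large) =
    n ∸ r , codim≤s , m∸n≤m n r , Span (fs ++ es) , span-subspace (fs ++ es) , dimension ,
    orthDecomp-from-bases fs es (Span (fs ++ es)) zero-subspace indep orth (span-++ˡ fs es) (span-++ʳ fs es) (λ _ u∈ → u∈)
    where
    r = suc (toℕ b) + suc (toℕ a)
    codim≤s : n ∸ r ≤ s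
    codim≤s = m≤n+o⇒m∸n≤o n r (≤-trans (m≤n+m∸n n s) (subst (s + (n ∸ s) ≤_) (+-comm s r) (+-monoʳ-≤ s large)))
    dimension : HasDim p (Span (fs ++ es)) (n ∸ (n ∸ r))
    dimension = subst (HasDim p (Span (fs ++ es))) (sym (m∸[m∸n]≡n (indep⇒≤ (fs ++ es) indep)))
                      (fs ++ es , indep , span-lookup (fs ++ es) , λ _ u∈ → u∈)

  module FromCentralDecomposition {s k} {S J K : P → Set} (S-subgroup : IsSubgroup S) (S-regular : Regular S)
    (derived-card : HasCard (Derived S) k) (S-card : HasCard S (p ^ (n ∸ s) * k))
    (J-subgroup : IsSubgroup J) (K-subgroup : IsSubgroup K) (J⊆S : ∀ x → J x → S x) (K⊆S : ∀ x → K x → S x)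
    (J-proper : ∃ λ h → S h × ¬ J h) (K-proper : ∃ λ h → S h × ¬ K h)
    (commute : ∀ j k → J j → K k → j · k ≡ k · j) (factor : ∀ h → S h → ∃₂ λ j k → J j × K k × h ≡ j · k) where

    orthogonal : ∀ b a → Img K b → Img J a → φ b a ≡ 0ᵥ m
    orthogonal b a (y , kb) (x , ja) = commute⇒orthogonal (b , y) (a , x) (sym (commute (a , x) (b , y) ja kb))

    image-cover : ∀ v → Img S v → ∃₂ λ u₁ u₂ → Img J u₁ × Img K u₂ × v ≡ u₁ +ᵥ u₂
    image-cover v (x , sx) with factor (v , x) sx
    ... | (j₁ , j₂) , (k₁ , k₂) , jj , kk , vx≡jk = j₁ , k₁ , (j₂ , jj) , (k₂ , kk) , cong proj₁ vx≡jk

    -- A family spanning US has at least n ∸ s members, since |S| ≤ pʳ · |[S,S]|.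
    spanning-bound : ∀ {r} (ws : Vec (V p n) r) → (∀ v → Img S v → Span ws v) → n ∸ s ≤ r
    spanning-bound ws spanning = ^-cancel (*-cancelʳ-≤ _ _ k ⦃ derived-card-nonZero S derived-card ⦄
      (regular-card-bound spans S S-subgroup S-regular derived-card S-card ws spanning))

    image-proper : ∀ H → IsSubgroup H → (∀ x → H x → S x) → (∃ λ h → S h × ¬ H h) → ¬ (∀ v → Img S v → Img H v)
    image-proper H H-subgroup H⊆S (h , sh , h∉H) full =
      h∉H (image-saturated spans S H S-subgroup S-regular H-subgroup H⊆S full h sh)

    certificate : All (λ u → Dec (Img J u)) (vectors n) → All (λ u → Dec (Img K u)) (vectors n) → KappaCertificate s
    certificate UJ? UK? with sum-basis (image-subspace J J-subgroup) image-cover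
                               (image-proper J J-subgroup J⊆S J-proper) (image-proper K K-subgroup K⊆S K-proper) UJ? UK?
    ... | sumBasis es fs indep es⊆UJ fs⊆UK spanning =
      indepPair {G = KappaCondition s} es fs indep
        ((λ i j → orthogonal _ _ (lookup⁺ fs⊆UK i) (lookup⁺ es⊆UJ j)) , spanning-bound (fs ++ es) spanning)

    -- Certificates are decidable, so excluded middle for UJ, UK may be assumed.
    κφ-bound : ∃ λ c → c ≤ s × κφ-cand p φ c
    κφ-bound = certificate⇒κφ s (decidable-stable (kappaCertificate? s) λ no-certificate →
      ¬¬-decide-all (Img J) (vectors n) λ UJ? → ¬¬-decide-all (Img K) (vectors n) λ UK? →
      no-certificate (certificate UJ? UK?))

  κP⇒κφ : ∀ s → κP-cand p φ s → ∃ λ c → c ≤ s × κφ-cand p φ c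
  κP⇒κφ s (_ , S , S-subgroup , S-regular , (k , derived-card , S-card) ,
           (J , K , J-subgroup , K-subgroup , _ , _ , J⊆S , K⊆S , _ , _ , J-proper , K-proper , commute , factor)) = κφ-bound
    where open FromCentralDecomposition {s} S-subgroup S-regular derived-card S-card J-subgroup K-subgroup J⊆S K⊆S
                                        J-proper K-proper commute factor

-- λ(φ) ≤ λ(P_φ): central decompositions of quotients P_φ/N give decompositions of quotients of φ.
module CentralToQuotient (p : ℕ) ⦃ _ : NonZero p ⦄ (p-prime : Prime p) (odd : p % 2 ≡ 1)
    {n m : ℕ} (φ : Bil p n m) (bil : IsBilinear p φ) (alt : IsAlternating p φ) (spans : ImageSpans p φ) where

  open import Data.Nat using (suc; _^_; _≤_; z≤n)
  open import Data.List using (List; map)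
  open import Data.List.Properties using (length-map)
  open import Data.List.Membership.Propositional using (_∈_; find; lose)
  open import Data.List.Membership.Propositional.Properties using (∈-map⁺; ∈-map⁻)
  open import Data.List.Relation.Unary.All as All using (All)
  open import Data.List.Relation.Unary.Any using (any?)
  open import Data.Vec using (Vec; []; _∷_; _++_; lookup)
  open import Data.Vec.Relation.Unary.All using () renaming (_∷_ to _V∷_; [] to V[])
  open import Data.Vec.Relation.Unary.All.Properties using (lookup⁺)
  open import Data.Fin using (zero)
  open import Data.Fin.Properties using (all?)
  open import Data.Product using (∃; ∃₂; _×_; _,_; proj₁; proj₂)
  open import Data.Unit using (⊤; tt)
  open import Data.Empty using (⊥-elim)
  open import Relation.Nullary using (¬_; Dec; yes; no)
  open import Relation.Nullary.Decidable using (_×-dec_; ¬?; decidable-stable)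
  open import Relation.Binary.PropositionalEquality
  open import Defs using (V; IsSubspace; FullSpace; λφ-cand; λP-cand)

  open GroupOfForm p p-prime odd φ bil alt
  open Enumeration using (Unique⊆⇒length≤; ∀-dec; ¬¬-decide-all)

  -- A finite certificate that λ(φ) ≤ d for a family xs of d vectors: non-empty
  -- families es, fs forming a basis of 𝔽ₚⁿ with φ(fs, es) ⊆ ⟨xs⟩.
  LambdaCondition : ∀ {d} → Vec (V p m) d → ∀ {a b} → Vec (V p n) (suc a) → Vec (V p n) (suc b) → Set
  LambdaCondition xs es fs = (∀ i j → Span xs (φ (lookup fs i) (lookup es j))) × (∀ v → Span (fs ++ es) v)

  LambdaCertificate : ∀ {d} → Vec (V p m) d → Set
  LambdaCertificate xs = IndepPair (LambdaCondition xs)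

  lambdaCertificate? : ∀ {d} (xs : Vec (V p m) d) → Dec (LambdaCertificate xs)
  lambdaCertificate? xs = indepPair? λ es fs →
    all? (λ i → all? (λ j → span? xs (φ (lookup fs i) (lookup es j)))) ×-dec ∀-dec (vectors n) vectors-complete (span? (fs ++ es))

  certificate⇒λφ : ∀ {d} (xs : Vec (V p m) d) → Indep xs → LambdaCertificate xs → λφ-cand p φ d
  certificate⇒λφ xs xs-indep (_ , _ , es , fs , indep , orth , spanning) =
    Span xs , span-subspace xs , (xs , xs-indep , span-lookup xs , λ _ w∈ → w∈) ,
    orthDecomp-from-bases fs es (FullSpace p) (span-subspace xs) indep orth (λ _ _ → tt) (λ _ _ → tt) (λ u _ → spanning u)

  module FromCentralDecomposition {s} {N J K : P → Set} (N-subgroup : IsSubgroup N) (N-central : Central N)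
    (N-card : HasCard N (p ^ s)) (J-subgroup : IsSubgroup J) (K-subgroup : IsSubgroup K)
    (J-nontrivial : ∃ λ j → J j × ¬ N (ι j · ε))
    (J-proper : ∃ λ h → Whole h × ¬ J h) (K-proper : ∃ λ h → Whole h × ¬ K h)
    (commute : ∀ j k → J j → K k → N (ι (j · k) · (k · j)))
    (factor : ∀ h → Whole h → ∃₂ λ j k → J j × K k × N (ι h · (j · k))) where

    Nlist : List P
    Nlist = proj₁ N-card

    N⇔∈ : ∀ x → (N x → x ∈ Nlist) × (x ∈ Nlist → N x)
    N⇔∈ = proj₂ (proj₂ (proj₂ N-card))

    -- A subgroup of P_φ with full image is everything, as [P,P] = 0 ⊕ 𝔽ₚᵐ.
    image-proper : ∀ H → IsSubgroup H → (∃ λ h → Whole h × ¬ H h) → ¬ (∀ v → Img H v)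
    image-proper H H-subgroup (h , _ , h∉H) full =
      h∉H (image-saturated spans Whole H (tt , (λ _ _ _ _ → tt) , (λ _ _ → tt)) whole-regular H-subgroup
                           (λ _ _ → tt) (λ v _ → full v) h tt)

    -- Case N ⊆ 0 ⊕ 𝔽ₚᵐ: then N = 0 ⊕ X and λ(φ) ≤ dim X ≤ s.
    module VerticalCase (N-vertical : ∀ x → N x → proj₁ x ≡ 0ᵥ n) where

      X : V p m → Set
      X y = N (0ᵥ n , y)

      X-subspace : IsSubspace p X
      X-subspace = proj₁ N-subgroup , X+ , additive⇒scalar-closed X (proj₁ N-subgroup) X+
        where
        X+ : ∀ u v → X u → X v → X (u +ᵥ v)
        X+ u v xu xv = subst N (·-vertˡ u (0ᵥ n , v)) (proj₁ (proj₂ N-subgroup) _ _ xu xv)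

      Xlist : List (V p m)
      Xlist = map proj₂ Nlist

      X⇒∈ : ∀ y → X y → y ∈ Xlist
      X⇒∈ y xy = ∈-map⁺ proj₂ (proj₁ (N⇔∈ _) xy)

      ∈⇒X : ∀ y → y ∈ Xlist → X y
      ∈⇒X y y∈ with ∈-map⁻ proj₂ y∈
      ... | (x₁ , x₂) , x∈ , refl = subst N (cong (_, x₂) (N-vertical _ (proj₂ (N⇔∈ _) x∈))) (proj₂ (N⇔∈ _) x∈)

      -- X has an explicit basis xs, of size at most s since |X| = |N| = pˢ.
      X-basis : Basis X Xlist
      X-basis = basis-of X Xlist (All.tabulate (λ {y} y∈ → yes (∈⇒X y y∈)))

      open Basis X-basis renaming (family to xs; independent to xs-indep; family⊆Q to xs⊆X; covers to xs-covers)

      dim≤s : dim ≤ s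
      dim≤s = ^-cancel (subst₂ _≤_ (length-spanList xs) (trans (length-map proj₂ Nlist) (proj₁ (proj₂ N-card)))
        (Unique⊆⇒length≤ (spanList-unique xs xs-indep)
          (λ {y} y∈ → X⇒∈ y (span⊆ X-subspace xs⊆X y (∈spanList⇒span xs y y∈)))))

      X⊆⟨xs⟩ : ∀ y → X y → Span xs y
      X⊆⟨xs⟩ y xy = xs-covers y (X⇒∈ y xy) xy

      orthogonal : ∀ b a → Img K b → Img J a → Span xs (φ b a)
      orthogonal b a (y , kb) (x , ja) = X⊆⟨xs⟩ _ (subst N (commutation-defect (a , x) (b , y)) (commute _ _ ja kb))

      image-cover : ∀ v → FullSpace p v → ∃₂ λ u₁ u₂ → Img J u₁ × Img K u₂ × v ≡ u₁ +ᵥ u₂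
      image-cover v _ with factor (v , 0ᵥ m) tt
      ... | (j₁ , j₂) , (k₁ , k₂) , jj , kk , v~jk =
        j₁ , k₁ , (j₂ , jj) , (k₂ , kk) , sym (vertical-quotient⇒same-first (v , 0ᵥ m) ((j₁ , j₂) · (k₁ , k₂)) (N-vertical _ v~jk))

      certificate : All (λ u → Dec (Img J u)) (vectors n) → All (λ u → Dec (Img K u)) (vectors n) → LambdaCertificate xs
      certificate UJ? UK? with sum-basis (image-subspace J J-subgroup) image-cover
                                 (λ full → image-proper J J-subgroup J-proper (λ v → full v tt))
                                 (λ full → image-proper K K-subgroup K-proper (λ v → full v tt)) UJ? UK?
      ... | sumBasis es fs indep es⊆UJ fs⊆UK spanning =
        indepPair {G = LambdaCondition xs} es fs indep
          ((λ i j → orthogonal _ _ (lookup⁺ fs⊆UK i) (lookup⁺ es⊆UJ j)) , (λ v → spanning v tt))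

      λφ-bound : ∃ λ c → c ≤ s × λφ-cand p φ c
      λφ-bound = dim , dim≤s , certificate⇒λφ xs xs-indep (decidable-stable (lambdaCertificate? xs) λ no-certificate →
        ¬¬-decide-all (Img J) (vectors n) λ UJ? → ¬¬-decide-all (Img K) (vectors n) λ UK? →
        no-certificate (certificate UJ? UK?))

    -- Case (v, y) ∈ N with v ≠ 0: v lies in the radical of φ and splits off, so λ(φ) = 0.
    module NonverticalCase (v : V p n) (y : V p m) (vy∈N : N (v , y)) (v≢0 : ¬ (v ≡ 0ᵥ n)) where

      radical : ∀ w → φ v w ≡ 0ᵥ m
      radical w = commute⇒orthogonal (v , y) (w , 0ᵥ m) (N-central (v , y) (w , 0ᵥ m) vy∈N)

      -- If v alone spanned 𝔽ₚⁿ, φ would vanish, hence 𝔽ₚᵐ = 0 and N = P_φ;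
      -- but J is non-trivial modulo N.
      v-not-spanning : ¬ (∀ u → Span (v ∷ []) u)
      v-not-spanning ⟨v⟩-full = proj₂ (proj₂ J-nontrivial) (N-everything _)
        where
        φ≡0 : ∀ u u' → φ u u' ≡ 0ᵥ m
        φ≡0 u u' = span⊆ (preimage-subspace zero-subspace (φ-linearˡ u')) (radical u' V∷ V[]) u (⟨v⟩-full u)
        𝔽ₚᵐ≡0 : ∀ z → z ≡ 0ᵥ m
        𝔽ₚᵐ≡0 z with spans z
        ... | _ , inImage , refl = sumList-closed zero-subspace (All.map (λ { (u , u' , refl) → φ≡0 u u' }) inImage)
        Nv : V p n → Set
        Nv u = N (u , 0ᵥ m)
        Nv+ : ∀ u u' → Nv u → Nv u' → Nv (u +ᵥ u')
        Nv+ u u' nu nu' = subst N (cong (u +ᵥ u' ,_) (𝔽ₚᵐ≡0 _)) (proj₁ (proj₂ N-subgroup) _ _ nu nu')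
        N-everything : ∀ x → N x
        N-everything (u , z) = subst N (cong (u ,_) (sym (𝔽ₚᵐ≡0 z)))
          (span⊆ (proj₁ N-subgroup , Nv+ , additive⇒scalar-closed Nv (proj₁ N-subgroup) Nv+)
                 (subst N (cong (v ,_) (𝔽ₚᵐ≡0 y)) vy∈N V∷ V[]) u (⟨v⟩-full u))

      -- Extending v to a basis fs, v of 𝔽ₚⁿ gives a certificate with X = 0.
      certificate : LambdaCertificate []
      certificate with extend (λ _ → ⊤) (v ∷ []) (indep-∷ v [] indep-[] (λ { ([] , 0≡v) → v≢0 (sym 0≡v) }))
                          (vectors n) (All.tabulate (λ _ → yes tt))
      ... | extension [] _ _ covers = ⊥-elim (v-not-spanning (λ u → covers u (vectors-complete u) tt))
      ... | extension fs@(_ ∷ _) indep _ covers = indepPair {G = LambdaCondition []} (v ∷ []) fs indep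
        ((λ { i zero → [] , sym (trans (φ-antisym v _) (trans (cong -ᵥ_ (radical _)) +ᵥ.ε⁻¹≈ε)) }) ,
         (λ u → covers u (vectors-complete u) tt))

      λφ-bound : ∃ λ c → c ≤ s × λφ-cand p φ c
      λφ-bound = 0 , z≤n , certificate⇒λφ [] indep-[] certificate

    λφ-bound : ∃ λ c → c ≤ s × λφ-cand p φ c
    λφ-bound with any? (λ x → ¬? (proj₁ x ≟ᵥ 0ᵥ n)) Nlist
    ... | yes nonvertical with find nonvertical
    ...   | (v , y) , x∈ , v≢0 = NonverticalCase.λφ-bound v y (proj₂ (N⇔∈ _) x∈) v≢0
    λφ-bound | no vertical = VerticalCase.λφ-bound λ x x∈N →
      decidable-stable (proj₁ x ≟ᵥ 0ᵥ n) (λ x₁≢0 → vertical (lose (proj₁ (N⇔∈ x) x∈N) x₁≢0))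

  λP⇒λφ : ∀ s → λP-cand p φ s → ∃ λ c → c ≤ s × λφ-cand p φ c
  λP⇒λφ s (N , N-subgroup , N-central , N-card ,
           (J , K , J-subgroup , K-subgroup , _ , _ , _ , _ , J-nontrivial , _ , J-proper , K-proper , commute , factor)) = λφ-bound
    where open FromCentralDecomposition {s} N-subgroup N-central N-card J-subgroup K-subgroup J-nontrivial J-proper K-proper commute factor

least-transfer : ∀ {ℓ} (Q R : ℕ → Set ℓ) → (∀ c → Q c → R c) → (∀ s → R s → ∃ λ c → c ≤ s × Q c)
               → ∀ c → IsLeast Q c ⇔ IsLeast R c
least-transfer Q R Q⇒R R⇒Q c = mk⇔ leastQ⇒leastR leastR⇒leastQ
  where
  leastQ⇒leastR : IsLeast Q c → IsLeast R c
  leastQ⇒leastR (qc , minimal) = Q⇒R c qc , λ s rs → let (c' , c'≤s , qc') = R⇒Q s rs in ≤-trans (minimal c' qc') c'≤s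
  leastR⇒leastQ : IsLeast R c → IsLeast Q c
  leastR⇒leastQ (rc , minimal) = let (c' , c'≤c , qc') = R⇒Q c rc in
    subst Q (≤-antisym c'≤c (minimal c' (Q⇒R c' qc'))) qc' , λ d qd → minimal d (Q⇒R d qd)

proposition2p9 : (p : ℕ) ⦃ _ : NonZero p ⦄ → Prime p → p % 2 ≡ 1
    → (n m : ℕ) (φ : Bil p n m)
    → IsBilinear p φ → IsAlternating p φ → ImageSpans p φ
    → (∀ c → IsLeast (κφ-cand p φ) c ⇔ IsLeast (κP-cand p φ) c)
    × (∀ c → IsLeast (λφ-cand p φ) c ⇔ IsLeast (λP-cand p φ) c)
proposition2p9 p p-prime odd n m φ bil alt spans =
  least-transfer _ _ (RestrictionToSubgroup.κφ⇒κP p p-prime odd φ bil alt spans) (SubgroupToRestriction.κP⇒κφ p p-prime odd φ bil alt spans) ,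
  least-transfer _ _ (QuotientToCentral.λφ⇒λP p p-prime odd φ bil alt) (CentralToQuotient.λP⇒λφ p p-prime odd φ bil alt spans)
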